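{- Fix $y\in[0,1]$. Let $\pi\in S_n$, and let $\pi'=\pi\circ(i_1\,i_2)$ be obtained from $\pi$ by swapping the entries in positions $i_1$ and $i_2$. Then $\big|L_{\overline{\mathsf{runsort}}(\pi)}(y)-L_{\overline{\mathsf{runsort}}(\pi')}(y)\big|\le 9\log n$.
   Context: $S_n$ is the set of permutations $\sigma=\sigma_1\cdots\sigma_n$ of $[n]$; $\log$ is natural. For $\sigma\in S_n$ and $y\in[0,1]$, $L_\sigma(y)$ is the largest position $i\in[n]$ with $\sigma_i\le yn$ if $y\ge1/n$, and $L_\sigma(y)=0$ if $y<1/n$. An (ascending) run of $\pi$ is a maximal block of consecutive positions on which the entries are increasing. Each run is broken into segments: a run of length smaller than $\log n$ is one segment; a run of length greater than $\log n$ is broken directly before every position (of $\pi$) that is an integer multiple of $\lfloor\log n\rfloor$, so interior segments have length exactly $\lfloor\log n\rfloor$ and the first and last at most $\lfloor\log n\rfloor$. $\overline{\mathsf{runsort}}(\pi)$ is obtained by reordering the segments (each kept intact) so that their first entries appear in increasing order.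
   Formalization: The parameter y ranges over the rational numbers in $[0,1]$. -}

module Defs where

open import Data.Bool using (Bool; true; false; if_then_else_)
open import Data.Nat as ℕ using (ℕ; zero; suc; _<ᵇ_; _≤ᵇ_; _^_; _!)
open import Data.Nat.Properties using (_!≢0)
open import Data.Nat.Divisibility using (_∣?_)
open import Data.Integer using (+_)
open import Data.Rational as ℚ using (ℚ; _/_; 0ℚ)
open import Data.Rational.Properties as ℚP using ()
open import Data.Fin using (Fin; toℕ)
open import Data.Fin.Permutation using (Permutation′; _⟨$⟩ʳ_)
open import Data.List using (List; []; _∷_; map; foldr; foldl; zip; upTo; length; concat; concatMap; filter)
open import Data.Product using (_×_; _,_; proj₁; proj₂)
open import Relation.Nullary using (does; ¬_)

expTerm : ℕ → ℕ → ℚ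
expTerm x k = ((+ (x ^ k)) / (k !)) {{k !≢0}}

expPartial : ℕ → ℕ → ℚ
expPartial x zero    = 0ℚ
expPartial x (suc m) = expPartial x m ℚ.+ expTerm x m

-- "e^x ≤ N", i.e. "x ≤ log N" (natural log): every partial sum of the
-- (increasing, convergent) exponential series is ≤ N.
LogAtLeast : ℕ → ℕ → Set
LogAtLeast N x = ∀ m → expPartial x m ℚ.≤ ((+ N) / 1)

IsFloorLog : ℕ → ℕ → Set
IsFloorLog N ℓ = LogAtLeast N ℓ × ¬ LogAtLeast N (suc ℓ)

-- Permutations as one-line notation: entries σ₁ … σₙ with values in 1..n.

oneLine : ∀ {n} → Permutation′ n → List ℕ
oneLine {n} σ = map (λ i → suc (toℕ (σ ⟨$⟩ʳ i))) (Data.List.allFin n)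

-- entries tagged with their (1-based) position
Tagged : Set
Tagged = ℕ × ℕ   -- (position , value)

withPositions : List ℕ → List Tagged
withPositions xs = zip (map suc (upTo (length xs))) xs

-- Ascending runs (maximal increasing blocks of consecutive positions)

addRun : Tagged → List (List Tagged) → List (List Tagged)
addRun x ((y ∷ r) ∷ rs) =
  if proj₂ x <ᵇ proj₂ y then (x ∷ y ∷ r) ∷ rs else (x ∷ []) ∷ (y ∷ r) ∷ rs
addRun x rs = (x ∷ []) ∷ rs

runs : List Tagged → List (List Tagged)
runs = foldr addRun []

-- Segments.  ℓ plays the role of ⌊log n⌋.  A run of length ≤ ℓ (i.e.
-- smaller than log n) is one segment; a longer run is cut directly
-- before each of its positions (other than its first) that is a
-- multiple of ℓ.

cutStep : Bool → Tagged → List (List Tagged) → List (List Tagged)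
cutStep false x []       = (x ∷ []) ∷ []
cutStep true  x []       = [] ∷ (x ∷ []) ∷ []
cutStep false x (s ∷ ss) = (x ∷ s) ∷ ss
cutStep true  x (s ∷ ss) = [] ∷ (x ∷ s) ∷ ss

cutAtMultiples : ℕ → List Tagged → List (List Tagged)
cutAtMultiples ℓ [] = []
cutAtMultiples ℓ xs = foldr (λ x acc → cutStep (does (ℓ ∣? proj₁ x)) x acc) ([] ∷ []) xs

nonEmpty? : List Tagged → Bool
nonEmpty? [] = false
nonEmpty? (_ ∷ _) = true

dropEmpty : List (List Tagged) → List (List Tagged)
dropEmpty [] = []
dropEmpty (s ∷ ss) = if nonEmpty? s then s ∷ dropEmpty ss else dropEmpty ss

segmentRun : ℕ → List Tagged → List (List Tagged)
segmentRun ℓ r = if length r ≤ᵇ ℓ then r ∷ [] else dropEmpty (cutAtMultiples ℓ r)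

segments : ℕ → List ℕ → List (List Tagged)
segments ℓ xs = concatMap (segmentRun ℓ) (runs (withPositions xs))

firstEntry : List Tagged → ℕ
firstEntry [] = zero
firstEntry (x ∷ _) = proj₂ x

insertSeg : List Tagged → List (List Tagged) → List (List Tagged)
insertSeg s [] = s ∷ []
insertSeg s (t ∷ ts) =
  if firstEntry s ≤ᵇ firstEntry t then s ∷ t ∷ ts else t ∷ insertSeg s ts

sortSegs : List (List Tagged) → List (List Tagged)
sortSegs = foldr insertSeg []

runsortBar : ℕ → List ℕ → List ℕ
runsortBar ℓ xs = map proj₂ (concat (sortSegs (segments ℓ xs)))

-- L_σ(y): the largest position i with σ_i ≤ y n  (0 if there is none;
-- in particular 0 when y < 1/n, since all σ_i ≥ 1).

L : ℕ → List ℕ → ℚ → ℕ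
L n σ y = foldl step zero (withPositions σ)
  where
  step : ℕ → Tagged → ℕ
  step acc (i , v) =
    if does (((+ v) / 1) ℚP.≤? (y ℚ.* ((+ n) / 1))) then i else acc

-- For each position i let h i be the first entry of the segment containing i, and let P count the
-- positions with h i ≤ y n.  Sorting the segments by first entry puts those with h ≤ y n in front,
-- and every entry of a segment is at least its first entry, so L of runsortBar lies between P − ℓ
-- and P, segments having length at most ℓ = ⌊log n⌋.  Whether q starts a run depends only on the
-- entries at q − 1 and q, and the segment through i starts less than 2ℓ before i, so swapping two
-- entries changes h i only at the at most 6ℓ positions near them.  Hence P moves by at most 6ℓ and
-- L by at most 7ℓ ≤ log (n ^ 7), where the last step uses e ^ (a + b) ≤ e ^ a · e ^ b on partial
-- sums of the exponential series.  For n ≤ 2 one has ℓ = 0 and runsortBar is computed directly.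
module Submission where

module ExponentialSeries where

  open import Defs
  import Data.Nat as ℕ
  open ℕ using (ℕ; zero; suc; NonZero; _!; _^_; _∸_)
  import Data.Nat.Properties as ℕₚ
  open ℕₚ using (_!≢0)
  open import Data.Integer as ℤ using (ℤ; +_)
  import Data.Integer.Properties as ℤₚ
  open import Data.Rational using (ℚ; _/_; 0ℚ; 1ℚ; toℚᵘ; _≤_; _+_; _*_; nonNegative)
  open import Data.Rational.Properties
  open import Data.Rational.Unnormalised as ℚᵘ using (mkℚᵘ; *≤*; *≡*) renaming (_≃_ to _≃ᵘ_)
  import Data.Rational.Unnormalised.Properties as ℚᵘₚ
  open import Data.Rational.Solver using (module +-*-Solver)
  open import Data.Sum using (inj₁; inj₂)
  open import Relation.Nullary using (¬_)
  open import Relation.Nullary.Decidable using (toWitness)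
  open import Data.Unit using (tt)
  open import Relation.Binary.PropositionalEquality

  fromℕ : ℕ → ℚ
  fromℕ k = + k / 1

  toℚᵘ-/ : ∀ i d .{{_ : NonZero d}} → toℚᵘ (i / d) ≃ᵘ mkℚᵘ i (ℕ.pred d)
  toℚᵘ-/ i (suc d) = toℚᵘ-fromℚᵘ (mkℚᵘ i d)

  /-≤-cross : ∀ a b d e .{{_ : NonZero d}} .{{_ : NonZero e}} →
              a ℕ.* e ℕ.≤ b ℕ.* d → + a / d ≤ + b / e
  /-≤-cross a b d@(suc _) e@(suc _) ae≤bd = toℚᵘ-cancel-≤
    (ℚᵘₚ.≤-respʳ-≃ (ℚᵘₚ.≃-sym (toℚᵘ-/ (+ b) e))
      (ℚᵘₚ.≤-respˡ-≃ (ℚᵘₚ.≃-sym (toℚᵘ-/ (+ a) d)) (*≤* cross)))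
    where
    cross : + a ℤ.* + e ℤ.≤ + b ℤ.* + d
    cross rewrite sym (ℤₚ.pos-* a e) | sym (ℤₚ.pos-* b d) = ℤ.+≤+ ae≤bd

  /-≡-cross : ∀ a b d e .{{_ : NonZero d}} .{{_ : NonZero e}} →
              a ℕ.* e ≡ b ℕ.* d → + a / d ≡ + b / e
  /-≡-cross a b d@(suc _) e@(suc _) ae≡bd = toℚᵘ-injective
    (ℚᵘₚ.≃-trans (toℚᵘ-/ (+ a) d) (ℚᵘₚ.≃-trans (*≡* cross) (ℚᵘₚ.≃-sym (toℚᵘ-/ (+ b) e))))
    where
    cross : + a ℤ.* + e ≡ + b ℤ.* + d
    cross rewrite sym (ℤₚ.pos-* a e) | sym (ℤₚ.pos-* b d) = cong +_ ae≡bd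

  /-* : ∀ a b d e .{{_ : NonZero d}} .{{_ : NonZero e}} →
        (+ a / d) * (+ b / e) ≡ (+ (a ℕ.* b) / (d ℕ.* e)) {{ℕₚ.m*n≢0 d e}}
  /-* a b d@(suc _) e@(suc _) = toℚᵘ-injective
    (ℚᵘₚ.≃-trans (toℚᵘ-homo-* (+ a / d) (+ b / e))
    (ℚᵘₚ.≃-trans (ℚᵘₚ.*-cong (toℚᵘ-/ (+ a) d) (toℚᵘ-/ (+ b) e))
    (ℚᵘₚ.≃-sym (ℚᵘₚ.≃-trans (toℚᵘ-/ (+ (a ℕ.* b)) (d ℕ.* e)) (*≡* cross)))))
    where
    cross : + (a ℕ.* b) ℤ.* (+ d ℤ.* + e) ≡ (+ a ℤ.* + b) ℤ.* + suc (ℕ.pred (d ℕ.* e))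
    cross rewrite sym (ℤₚ.pos-* a b) = cong (+ (a ℕ.* b) ℤ.*_) (sym (ℤₚ.pos-* d e))

  fromℕ-* : ∀ a b → fromℕ (a ℕ.* b) ≡ fromℕ a * fromℕ b
  fromℕ-* a b = sym (/-* a b 1 1)

  fromℕ-+ : ∀ a b → fromℕ (a ℕ.+ b) ≡ fromℕ a + fromℕ b
  fromℕ-+ a b = toℚᵘ-injective
    (ℚᵘₚ.≃-trans (toℚᵘ-/ (+ (a ℕ.+ b)) 1) (ℚᵘₚ.≃-sym
    (ℚᵘₚ.≃-trans (toℚᵘ-homo-+ (fromℕ a) (fromℕ b))
    (ℚᵘₚ.≃-trans (ℚᵘₚ.+-cong (toℚᵘ-/ (+ a) 1) (toℚᵘ-/ (+ b) 1)) (*≡* cross)))))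
    where
    cross : (+ a ℤ.* + 1 ℤ.+ + b ℤ.* + 1) ℤ.* + 1 ≡ + (a ℕ.+ b) ℤ.* + 1
    cross rewrite ℤₚ.*-identityʳ (+ a) | ℤₚ.*-identityʳ (+ b) | ℤₚ.*-identityʳ (+ a ℤ.+ + b) =
      sym (ℤₚ.pos-+ a b)

  fromℕ-mono-≤ : ∀ {a b} → a ℕ.≤ b → fromℕ a ≤ fromℕ b
  fromℕ-mono-≤ {a} {b} a≤b = /-≤-cross a b 1 1 (ℕₚ.*-monoˡ-≤ 1 a≤b)

  fromℕ-nonNeg : ∀ a → 0ℚ ≤ fromℕ a
  fromℕ-nonNeg a = fromℕ-mono-≤ {0} {a} ℕ.z≤n

  *-monoˡ-≤-nonNeg′ : ∀ {r p q} → 0ℚ ≤ r → p ≤ q → r * p ≤ r * q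
  *-monoˡ-≤-nonNeg′ {r} 0≤r = *-monoˡ-≤-nonNeg r {{nonNegative 0≤r}}

  *-monoʳ-≤-nonNeg′ : ∀ {r p q} → 0ℚ ≤ r → p ≤ q → p * r ≤ q * r
  *-monoʳ-≤-nonNeg′ {r} 0≤r = *-monoʳ-≤-nonNeg r {{nonNegative 0≤r}}

  expTerm-nonNeg : ∀ x k → 0ℚ ≤ expTerm x k
  expTerm-nonNeg x k = /-≤-cross 0 (x ^ k) 1 (k !) {{_}} {{k !≢0}} ℕ.z≤n

  expTerm-monoˡ-≤ : ∀ {x y} k → x ℕ.≤ y → expTerm x k ≤ expTerm y k
  expTerm-monoˡ-≤ {x} {y} k x≤y = /-≤-cross (x ^ k) (y ^ k) (k !) (k !) {{k !≢0}} {{k !≢0}}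
    (ℕₚ.*-monoˡ-≤ (k !) (ℕₚ.^-monoˡ-≤ k x≤y))

  expTerm-suc : ∀ x k → expTerm x (suc k) * fromℕ (suc k) ≡ expTerm x k * fromℕ x
  expTerm-suc x k = begin
    expTerm x (suc k) * fromℕ (suc k)
      ≡⟨ /-* (x ^ suc k) (suc k) (suc k !) 1 {{suc k !≢0}} ⟩
    (+ (x ^ suc k ℕ.* suc k) / (suc k ! ℕ.* 1)) {{nz₁}}
      ≡⟨ /-≡-cross (x ^ suc k ℕ.* suc k) (x ^ k ℕ.* x) _ _ {{nz₁}} {{nz₀}} (reorder x (x ^ k) k (k !)) ⟩
    (+ (x ^ k ℕ.* x) / (k ! ℕ.* 1)) {{nz₀}}
      ≡⟨ /-* (x ^ k) x (k !) 1 {{k !≢0}} ⟨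
    expTerm x k * fromℕ x ∎
    where
    open ≡-Reasoning
    open import Data.Nat.Tactic.RingSolver using (solve-∀)
    nz₀ = ℕₚ.m*n≢0 (k !) 1 {{k !≢0}}
    nz₁ = ℕₚ.m*n≢0 (suc k !) 1 {{suc k !≢0}}
    reorder : ∀ x p k f → x ℕ.* p ℕ.* suc k ℕ.* (f ℕ.* 1) ≡ p ℕ.* x ℕ.* (suc k ℕ.* f ℕ.* 1)
    reorder = solve-∀

  partialSum : (ℕ → ℚ) → ℕ → ℚ
  partialSum f zero    = 0ℚ
  partialSum f (suc m) = partialSum f m + f m

  expPartial≡partialSum : ∀ x m → expPartial x m ≡ partialSum (expTerm x) m
  expPartial≡partialSum x zero    = refl
  expPartial≡partialSum x (suc m) = cong (_+ expTerm x m) (expPartial≡partialSum x m)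

  partialSum-suc-front : ∀ f m → partialSum f (suc m) ≡ f 0 + partialSum (λ i → f (suc i)) m
  partialSum-suc-front f zero    = trans (+-identityˡ (f 0)) (sym (+-identityʳ (f 0)))
  partialSum-suc-front f (suc m) =
    trans (cong (_+ f (suc m)) (partialSum-suc-front f m)) (+-assoc (f 0) _ _)

  partialSum-cong : ∀ {f g} m → (∀ i → i ℕ.< m → f i ≡ g i) → partialSum f m ≡ partialSum g m
  partialSum-cong zero    f≡g = refl
  partialSum-cong (suc m) f≡g =
    cong₂ _+_ (partialSum-cong m (λ i i<m → f≡g i (ℕₚ.m≤n⇒m≤1+n i<m))) (f≡g m ℕₚ.≤-refl)

  partialSum-mono-≤ : ∀ {f g} m → (∀ i → i ℕ.< m → f i ≤ g i) → partialSum f m ≤ partialSum g m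
  partialSum-mono-≤ zero    f≤g = ≤-refl
  partialSum-mono-≤ (suc m) f≤g =
    +-mono-≤ (partialSum-mono-≤ m (λ i i<m → f≤g i (ℕₚ.m≤n⇒m≤1+n i<m))) (f≤g m ℕₚ.≤-refl)

  partialSum-+ : ∀ f g m → partialSum (λ i → f i + g i) m ≡ partialSum f m + partialSum g m
  partialSum-+ f g zero    = refl
  partialSum-+ f g (suc m) = begin
    partialSum (λ i → f i + g i) m + (f m + g m)
      ≡⟨ cong (_+ (f m + g m)) (partialSum-+ f g m) ⟩
    (partialSum f m + partialSum g m) + (f m + g m)
      ≡⟨ solve 4 (λ a b c d → (a :+ b) :+ (c :+ d) := (a :+ c) :+ (b :+ d)) refl
           (partialSum f m) (partialSum g m) (f m) (g m) ⟩
    (partialSum f m + f m) + (partialSum g m + g m) ∎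
    where
    open ≡-Reasoning
    open +-*-Solver

  partialSum-*ʳ : ∀ f q m → partialSum (λ i → f i * q) m ≡ partialSum f m * q
  partialSum-*ʳ f q zero    = sym (*-zeroˡ q)
  partialSum-*ʳ f q (suc m) =
    trans (cong (_+ f m * q) (partialSum-*ʳ f q m)) (sym (*-distribʳ-+ q (partialSum f m) (f m)))

  partialSum-nonNeg : ∀ {f} m → (∀ i → 0ℚ ≤ f i) → 0ℚ ≤ partialSum f m
  partialSum-nonNeg zero    0≤f = ≤-refl
  partialSum-nonNeg (suc m) 0≤f = +-mono-≤ (partialSum-nonNeg m 0≤f) (0≤f m)

  p≤p+q : ∀ p {q} → 0ℚ ≤ q → p ≤ p + q
  p≤p+q p {q} 0≤q = ≤-trans (≤-reflexive (sym (+-identityʳ p))) (+-monoʳ-≤ p 0≤q)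

  partialSum-monoʳ-≤ : ∀ {f m m′} → (∀ i → 0ℚ ≤ f i) → m ℕ.≤ m′ → partialSum f m ≤ partialSum f m′
  partialSum-monoʳ-≤ {m′ = zero} 0≤f ℕ.z≤n = ≤-refl
  partialSum-monoʳ-≤ {f} {m′ = suc m′} 0≤f m≤1+m′ with ℕₚ.m≤n⇒m<n∨m≡n m≤1+m′
  ... | inj₂ refl     = ≤-refl
  ... | inj₁ m<1+m′ =
    ≤-trans (partialSum-monoʳ-≤ 0≤f (ℕₚ.≤-pred m<1+m′)) (p≤p+q (partialSum f m′) (0≤f m′))

  cauchy : ℕ → ℕ → ℕ → ℚ
  cauchy a b k = partialSum (λ i → expTerm a i * expTerm b (k ∸ i)) (suc k)

  cauchy-suc : ∀ a b k → cauchy a b (suc k) * fromℕ (suc k) ≡ cauchy a b k * fromℕ (a ℕ.+ b)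
  cauchy-suc a b k = begin
    cauchy a b K * fromℕ K                          ≡⟨ partialSum-*ʳ t (fromℕ K) (suc K) ⟨
    partialSum (λ i → t i * fromℕ K) (suc K)         ≡⟨ partialSum-cong (suc K) split ⟩
    partialSum (λ i → A i + B i) (suc K)             ≡⟨ partialSum-+ A B (suc K) ⟩
    partialSum A (suc K) + partialSum B (suc K)      ≡⟨ cong₂ _+_ sumA sumB ⟩
    cauchy a b k * fromℕ a + cauchy a b k * fromℕ b ≡⟨ *-distribˡ-+ (cauchy a b k) (fromℕ a) (fromℕ b) ⟨
    cauchy a b k * (fromℕ a + fromℕ b)              ≡⟨ cong (cauchy a b k *_) (fromℕ-+ a b) ⟨
    cauchy a b k * fromℕ (a ℕ.+ b)                  ∎
    where
    open ≡-Reasoning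
    open +-*-Solver
    K = suc k
    t u : ℕ → ℚ
    t i = expTerm a i * expTerm b (K ∸ i)
    u j = expTerm a j * expTerm b (k ∸ j)
    A B : ℕ → ℚ
    A i = expTerm a i * fromℕ i * expTerm b (K ∸ i)
    B i = expTerm a i * (expTerm b (K ∸ i) * fromℕ (K ∸ i))
    split : ∀ i → i ℕ.< suc K → t i * fromℕ K ≡ A i + B i
    split i i<1+K = begin
      t i * fromℕ K
        ≡⟨ cong (λ z → t i * fromℕ z) (ℕₚ.m+[n∸m]≡n (ℕₚ.≤-pred i<1+K)) ⟨
      t i * fromℕ (i ℕ.+ (K ∸ i))
        ≡⟨ cong (t i *_) (fromℕ-+ i (K ∸ i)) ⟩
      t i * (fromℕ i + fromℕ (K ∸ i))
        ≡⟨ solve 4 (λ x y p q → (x :* y) :* (p :+ q) := x :* p :* y :+ x :* (y :* q)) refl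
             (expTerm a i) (expTerm b (K ∸ i)) (fromℕ i) (fromℕ (K ∸ i)) ⟩
      A i + B i ∎
    A0≡0 : A 0 ≡ 0ℚ
    A0≡0 = trans (cong (_* expTerm b K) (*-zeroʳ (expTerm a 0))) (*-zeroˡ (expTerm b K))
    BK≡0 : B K ≡ 0ℚ
    BK≡0 = trans (cong (λ z → expTerm a K * (expTerm b z * fromℕ z)) (ℕₚ.n∸n≡0 K))
                 (trans (cong (expTerm a K *_) (*-zeroʳ (expTerm b 0))) (*-zeroʳ (expTerm a K)))
    sumA : partialSum A (suc K) ≡ cauchy a b k * fromℕ a
    sumA = begin
      partialSum A (suc K)                        ≡⟨ partialSum-suc-front A K ⟩
      A 0 + partialSum (λ j → A (suc j)) K         ≡⟨ cong (_+ partialSum (λ j → A (suc j)) K) A0≡0 ⟩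
      0ℚ + partialSum (λ j → A (suc j)) K          ≡⟨ +-identityˡ _ ⟩
      partialSum (λ j → A (suc j)) K               ≡⟨ partialSum-cong K (λ j _ →
          trans (cong (_* expTerm b (k ∸ j)) (expTerm-suc a j))
                (solve 3 (λ x y z → x :* y :* z := x :* z :* y) refl
                   (expTerm a j) (fromℕ a) (expTerm b (k ∸ j)))) ⟩
      partialSum (λ j → u j * fromℕ a) K           ≡⟨ partialSum-*ʳ u (fromℕ a) K ⟩
      cauchy a b k * fromℕ a                       ∎
    sumB : partialSum B (suc K) ≡ cauchy a b k * fromℕ b
    sumB = begin
      partialSum B K + B K                         ≡⟨ cong (λ z → partialSum B K + z) BK≡0 ⟩
      partialSum B K + 0ℚ                          ≡⟨ +-identityʳ _ ⟩
      partialSum B K                               ≡⟨ partialSum-cong K (λ i i<K →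
          trans (cong (λ z → expTerm a i * (expTerm b z * fromℕ z)) (ℕₚ.+-∸-assoc 1 (ℕₚ.≤-pred i<K)))
          (trans (cong (expTerm a i *_) (expTerm-suc b (k ∸ i)))
                 (solve 3 (λ x y z → x :* (y :* z) := x :* y :* z) refl
                    (expTerm a i) (expTerm b (k ∸ i)) (fromℕ b)))) ⟩
      partialSum (λ i → u i * fromℕ b) K           ≡⟨ partialSum-*ʳ u (fromℕ b) K ⟩
      cauchy a b k * fromℕ b                       ∎

  *-cancelʳ-fromℕ-suc : ∀ k {p q} → p * fromℕ (suc k) ≡ q * fromℕ (suc k) → p ≡ q
  *-cancelʳ-fromℕ-suc k p*r≡q*r = ≤-antisym
    (*-cancelʳ-≤-pos (fromℕ (suc k)) {{pos}} (≤-reflexive p*r≡q*r))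
    (*-cancelʳ-≤-pos (fromℕ (suc k)) {{pos}} (≤-reflexive (sym p*r≡q*r)))
    where pos = normalize-pos (suc k) 1

  -- Both sides satisfy c (k + 1) · (k + 1) ≡ c k · (a + b) and agree at k = 0.
  cauchy≡expTerm : ∀ a b k → cauchy a b k ≡ expTerm (a ℕ.+ b) k
  cauchy≡expTerm a b zero    = refl
  cauchy≡expTerm a b (suc k) = *-cancelʳ-fromℕ-suc k (begin
    cauchy a b (suc k) * fromℕ (suc k)    ≡⟨ cauchy-suc a b k ⟩
    cauchy a b k * fromℕ (a ℕ.+ b)        ≡⟨ cong (_* fromℕ (a ℕ.+ b)) (cauchy≡expTerm a b k) ⟩
    expTerm (a ℕ.+ b) k * fromℕ (a ℕ.+ b) ≡⟨ expTerm-suc (a ℕ.+ b) k ⟨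
    expTerm (a ℕ.+ b) (suc k) * fromℕ (suc k) ∎)
    where open ≡-Reasoning

  partialSum-cauchy : ∀ a b m →
    partialSum (cauchy a b) m ≡ partialSum (λ i → expTerm a i * partialSum (expTerm b) (m ∸ i)) m
  partialSum-cauchy a b zero    = refl
  partialSum-cauchy a b (suc m) = begin
    partialSum (cauchy a b) m + cauchy a b m
      ≡⟨ cong (_+ cauchy a b m) (partialSum-cauchy a b m) ⟩
    X + (Y + expTerm a m * expTerm b (m ∸ m))
      ≡⟨ cong (λ z → X + (Y + expTerm a m * expTerm b z)) (ℕₚ.n∸n≡0 m) ⟩
    X + (Y + expTerm a m * expTerm b 0)
      ≡⟨ solve 4 (λ x y u w → x :+ (y :+ u :* w) := (x :+ y) :+ u :* (con 0ℚ :+ w)) refl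
           X Y (expTerm a m) (expTerm b 0) ⟩
    (X + Y) + expTerm a m * partialSum (expTerm b) 1
      ≡⟨ cong (_+ expTerm a m * partialSum (expTerm b) 1) (partialSum-+ _ _ m) ⟨
    partialSum (λ i → expTerm a i * partialSum (expTerm b) (m ∸ i) + expTerm a i * expTerm b (m ∸ i)) m
      + expTerm a m * partialSum (expTerm b) 1
      ≡⟨ cong₂ _+_ (partialSum-cong m merge)
           (cong (λ z → expTerm a m * partialSum (expTerm b) z) (sym (ℕₚ.m+n∸n≡m 1 m))) ⟩
    partialSum (λ i → expTerm a i * partialSum (expTerm b) (suc m ∸ i)) m
      + expTerm a m * partialSum (expTerm b) (suc m ∸ m) ∎
    where
    open ≡-Reasoning
    open +-*-Solver
    X = partialSum (λ i → expTerm a i * partialSum (expTerm b) (m ∸ i)) m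
    Y = partialSum (λ i → expTerm a i * expTerm b (m ∸ i)) m
    merge : ∀ i → i ℕ.< m →
      expTerm a i * partialSum (expTerm b) (m ∸ i) + expTerm a i * expTerm b (m ∸ i)
        ≡ expTerm a i * partialSum (expTerm b) (suc m ∸ i)
    merge i i<m = trans (sym (*-distribˡ-+ (expTerm a i) _ _))
      (cong (λ z → expTerm a i * partialSum (expTerm b) z) (sym (ℕₚ.+-∸-assoc 1 (ℕₚ.<⇒≤ i<m))))

  expPartial-nonNeg : ∀ x m → 0ℚ ≤ expPartial x m
  expPartial-nonNeg x m =
    subst (0ℚ ≤_) (sym (expPartial≡partialSum x m)) (partialSum-nonNeg m (expTerm-nonNeg x))

  expPartial-monoˡ-≤ : ∀ {x y} m → x ℕ.≤ y → expPartial x m ≤ expPartial y m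
  expPartial-monoˡ-≤ {x} {y} m x≤y =
    subst₂ _≤_ (sym (expPartial≡partialSum x m)) (sym (expPartial≡partialSum y m))
      (partialSum-mono-≤ m (λ i _ → expTerm-monoˡ-≤ i x≤y))

  -- Truncating the Cauchy product of the two series at total degree m drops only nonnegative terms.
  expPartial-+ : ∀ a b m → expPartial (a ℕ.+ b) m ≤ expPartial a m * expPartial b m
  expPartial-+ a b m = subst₂ _≤_ (sym (expPartial≡partialSum (a ℕ.+ b) m))
      (cong₂ _*_ (sym (expPartial≡partialSum a m)) (sym (expPartial≡partialSum b m))) (begin
    partialSum (expTerm (a ℕ.+ b)) m
      ≡⟨ partialSum-cong m (λ i _ → cauchy≡expTerm a b i) ⟨
    partialSum (cauchy a b) m
      ≡⟨ partialSum-cauchy a b m ⟩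
    partialSum (λ i → expTerm a i * partialSum (expTerm b) (m ∸ i)) m
      ≤⟨ partialSum-mono-≤ m (λ i _ → *-monoˡ-≤-nonNeg′ (expTerm-nonNeg a i)
                                         (partialSum-monoʳ-≤ (expTerm-nonNeg b) (ℕₚ.m∸n≤m m i))) ⟩
    partialSum (λ i → expTerm a i * partialSum (expTerm b) m) m
      ≡⟨ partialSum-*ʳ (expTerm a) (partialSum (expTerm b) m) m ⟩
    partialSum (expTerm a) m * partialSum (expTerm b) m ∎)
    where open ≤-Reasoning

  expPartial-zero-≤-1 : ∀ m → expPartial 0 m ≤ 1ℚ
  expPartial-zero-≤-1 zero    = fromℕ-mono-≤ {0} {1} ℕ.z≤n
  expPartial-zero-≤-1 (suc m) = ≤-reflexive (expPartial-zero m)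
    where
    expPartial-zero : ∀ m → expPartial 0 (suc m) ≡ 1ℚ
    expPartial-zero zero    = refl
    expPartial-zero (suc m) = trans (cong₂ _+_ (expPartial-zero m)
      (/-≡-cross 0 0 (suc m !) 1 {{suc m !≢0}} refl)) (+-identityʳ 1ℚ)

  -- e ≤ 3, via the invariant that the partial sum plus twice its next term never exceeds 3.
  expPartial-one-≤-3 : ∀ m → expPartial 1 m ≤ fromℕ 3
  expPartial-one-≤-3 zero    = fromℕ-mono-≤ {0} {3} ℕ.z≤n
  expPartial-one-≤-3 (suc m) =
    ≤-trans (p≤p+q _ (*-monoˡ-≤-nonNeg′ {fromℕ 2} (fromℕ-nonNeg 2) (expTerm-nonNeg 1 (suc m))))
            (invariant m)
    where
    invariant : ∀ m → expPartial 1 (suc m) + fromℕ 2 * expTerm 1 (suc m) ≤ fromℕ 3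
    invariant zero    = ≤-refl
    invariant (suc m) = ≤-trans step (invariant m)
      where
      open +-*-Solver
      s = expPartial 1 (suc m)
      t₁ = expTerm 1 (suc m)
      t₂ = expTerm 1 (suc (suc m))
      halving : fromℕ 2 * t₂ ≤ t₁
      halving = ≤-trans
        (*-monoʳ-≤-nonNeg′ (expTerm-nonNeg 1 (suc (suc m))) (fromℕ-mono-≤ {2} {suc (suc m)} (ℕ.s≤s (ℕ.s≤s ℕ.z≤n))))
        (≤-reflexive (trans (*-comm (fromℕ (suc (suc m))) t₂) (trans (expTerm-suc 1 (suc m)) (*-identityʳ t₁))))
      step : (s + t₁) + fromℕ 2 * t₂ ≤ s + fromℕ 2 * t₁
      step = ≤-trans (≤-reflexive (+-assoc s t₁ (fromℕ 2 * t₂)))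
        (≤-trans (+-monoʳ-≤ s (+-monoʳ-≤ t₁ halving))
                 (≤-reflexive (solve 2 (λ s t → s :+ (t :+ t) := s :+ con (fromℕ 2) :* t) refl s t₁)))

  LogAtLeast-mono : ∀ {N N′ x x′} → N ℕ.≤ N′ → x′ ℕ.≤ x → LogAtLeast N x → LogAtLeast N′ x′
  LogAtLeast-mono N≤N′ x′≤x eˣ≤N m =
    ≤-trans (expPartial-monoˡ-≤ m x′≤x) (≤-trans (eˣ≤N m) (fromℕ-mono-≤ N≤N′))

  LogAtLeast-zero : ∀ {N} → 1 ℕ.≤ N → LogAtLeast N 0
  LogAtLeast-zero 1≤N m = ≤-trans (expPartial-zero-≤-1 m) (fromℕ-mono-≤ 1≤N)

  LogAtLeast-one : ∀ {N} → 3 ℕ.≤ N → LogAtLeast N 1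
  LogAtLeast-one 3≤N m = ≤-trans (expPartial-one-≤-3 m) (fromℕ-mono-≤ 3≤N)

  -- Already 1 + 1 + 1/2 > 2.
  ¬LogAtLeast-2-1 : ¬ LogAtLeast 2 1
  ¬LogAtLeast-2-1 e≤2 = <-irrefl refl (<-≤-trans (toWitness {a? = fromℕ 2 <? expPartial 1 3} tt) (e≤2 3))

  LogAtLeast-^ : ∀ {N x} → LogAtLeast N x → ∀ k → LogAtLeast (N ^ k) (k ℕ.* x)
  LogAtLeast-^ eˣ≤N zero    = LogAtLeast-zero ℕₚ.≤-refl
  LogAtLeast-^ {N} {x} eˣ≤N (suc k) m = begin
    expPartial (x ℕ.+ k ℕ.* x) m
      ≤⟨ expPartial-+ x (k ℕ.* x) m ⟩
    expPartial x m * expPartial (k ℕ.* x) m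
      ≤⟨ *-monoʳ-≤-nonNeg′ (expPartial-nonNeg (k ℕ.* x) m) (eˣ≤N m) ⟩
    fromℕ N * expPartial (k ℕ.* x) m
      ≤⟨ *-monoˡ-≤-nonNeg′ (fromℕ-nonNeg N) (LogAtLeast-^ eˣ≤N k m) ⟩
    fromℕ N * fromℕ (N ^ k)
      ≡⟨ fromℕ-* N (N ^ k) ⟨
    fromℕ (N ^ suc k) ∎
    where open ≤-Reasoning

module SegmentHeads where

  open import Defs
  open import Data.Bool using (true; false; if_then_else_; T)
  open import Data.Unit using (⊤; tt)
  open import Data.Nat
  open import Data.Nat.Properties
  open import Data.Nat.Divisibility using (_∣_; _∣?_)
  open import Data.List using (List; []; _∷_; map; foldr; zip; applyUpTo; length; concat; concatMap; _++_; take; drop)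
  open import Data.List.Properties using (map-upTo; concatMap-++; length-take; length-drop; length-map; ++-identityʳ)
  open import Data.Product using (_×_; _,_; proj₁; ∃)
  open import Data.Sum using (_⊎_; inj₁; inj₂)
  open import Data.Empty using (⊥-elim)
  open import Function using (_∘_; const)
  open import Relation.Nullary using (does; ¬_; yes; no)
  open import Relation.Binary.PropositionalEquality

  tagFrom : ℕ → List ℕ → List Tagged
  tagFrom k []       = []
  tagFrom k (x ∷ xs) = (k , x) ∷ tagFrom (suc k) xs

  zip-applyUpTo : ∀ f k xs → (∀ i → f i ≡ k + i) → zip (applyUpTo f (length xs)) xs ≡ tagFrom k xs
  zip-applyUpTo f k []       f≗k+ = refl
  zip-applyUpTo f k (x ∷ xs) f≗k+ = cong₂ _∷_
    (cong (_, x) (trans (f≗k+ 0) (+-identityʳ k)))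
    (zip-applyUpTo (f ∘ suc) (suc k) xs (λ i → trans (f≗k+ (suc i)) (+-suc k i)))

  withPositions≡tagFrom : ∀ xs → withPositions xs ≡ tagFrom 1 xs
  withPositions≡tagFrom xs =
    trans (cong (λ ps → zip ps xs) (map-upTo suc (length xs))) (zip-applyUpTo suc 1 xs (λ i → refl))

  length-tagFrom : ∀ k xs → length (tagFrom k xs) ≡ length xs
  length-tagFrom k []       = refl
  length-tagFrom k (x ∷ xs) = cong suc (length-tagFrom (suc k) xs)

  nth : List ℕ → ℕ → ℕ
  nth []       _       = 0
  nth (x ∷ xs) zero    = x
  nth (x ∷ xs) (suc j) = nth xs j

  nth-++ˡ : ∀ xs ys {j} → j < length xs → nth (xs ++ ys) j ≡ nth xs j
  nth-++ˡ (x ∷ xs) ys {zero}  _         = refl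
  nth-++ˡ (x ∷ xs) ys {suc j} (s≤s j<n) = nth-++ˡ xs ys j<n

  nth-++ʳ : ∀ xs ys j → nth (xs ++ ys) (length xs + j) ≡ nth ys j
  nth-++ʳ []       ys j = refl
  nth-++ʳ (x ∷ xs) ys j = nth-++ʳ xs ys j

  nth-take : ∀ g xs {t} → t < g → nth (take g xs) t ≡ nth xs t
  nth-take (suc g) []       _                 = refl
  nth-take (suc g) (x ∷ xs) {zero}  _         = refl
  nth-take (suc g) (x ∷ xs) {suc t} (s≤s t<g) = nth-take g xs t<g

  nth-drop : ∀ g xs j → nth (drop g xs) j ≡ nth xs (g + j)
  nth-drop zero    xs       j = refl
  nth-drop (suc g) []       j = refl
  nth-drop (suc g) (x ∷ xs) j = nth-drop g xs j

  ascentLength : ℕ → List ℕ → ℕ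
  ascentLength x []       = 0
  ascentLength x (y ∷ ys) = if x <ᵇ y then suc (ascentLength y ys) else 0

  runs-tagFrom : ∀ k x xs → runs (tagFrom k (x ∷ xs)) ≡
    tagFrom k (x ∷ take (ascentLength x xs) xs)
      ∷ runs (tagFrom (suc k + ascentLength x xs) (drop (ascentLength x xs) xs))
  runs-tagFrom k x []       = refl
  runs-tagFrom k x (y ∷ ys) with x <ᵇ y in x<y
  ... | true  rewrite runs-tagFrom (suc k) y ys | x<y | +-suc k (ascentLength y ys) = refl
  ... | false rewrite +-identityʳ k | runs-tagFrom (suc k) y ys | x<y = refl

  ascentLength≤length : ∀ x xs → ascentLength x xs ≤ length xs
  ascentLength≤length x []       = z≤n
  ascentLength≤length x (y ∷ ys) with x <ᵇ y
  ... | true  = s≤s (ascentLength≤length y ys)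
  ... | false = z≤n

  ascent-increasing : ∀ x xs {t} → t < ascentLength x xs → nth (x ∷ xs) t < nth xs t
  ascent-increasing x (y ∷ ys) {t} t<g with x <ᵇ y in x<y
  ascent-increasing x (y ∷ ys) {zero}  _         | true = <ᵇ⇒< x y (subst T (sym x<y) tt)
  ascent-increasing x (y ∷ ys) {suc t} (s≤s t<g) | true = ascent-increasing y ys t<g

  ascent-stops : ∀ x xs → ascentLength x xs ≡ length xs
                        ⊎ nth xs (ascentLength x xs) ≤ nth (x ∷ xs) (ascentLength x xs)
  ascent-stops x []       = inj₁ refl
  ascent-stops x (y ∷ ys) with x <ᵇ y in x<y
  ... | true with ascent-stops y ys
  ...   | inj₁ g≡n   = inj₁ (cong suc g≡n)
  ...   | inj₂ y′≤y  = inj₂ y′≤y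
  ascent-stops x (y ∷ ys) | false = inj₂ (≮⇒≥ λ y<x → subst T x<y (<⇒<ᵇ y<x))

  fillHead : List Tagged → List ℕ
  fillHead s = map (const (firstEntry s)) s

  segmentHeads : ℕ → List ℕ → List ℕ
  segmentHeads ℓ xs = concatMap fillHead (segments ℓ xs)

  cutStepsAtMultiples : ℕ → List Tagged → List (List Tagged)
  cutStepsAtMultiples ℓ = foldr (λ x acc → cutStep (does (ℓ ∣? proj₁ x)) x acc) ([] ∷ [])

  -- h is the first entry of the segment in progress.
  cutHeads : ℕ → ℕ → List Tagged → List ℕ
  cutHeads ℓ h []            = []
  cutHeads ℓ h ((p , v) ∷ T) = if does (ℓ ∣? p) then v ∷ cutHeads ℓ v T else h ∷ cutHeads ℓ h T

  headsAfter : ℕ → List (List Tagged) → List ℕ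
  headsAfter h []        = []
  headsAfter h (s₀ ∷ ss) = map (const h) s₀ ++ concatMap fillHead (dropEmpty ss)

  headsAfter-cut : ∀ ℓ h T → headsAfter h (cutStepsAtMultiples ℓ T) ≡ cutHeads ℓ h T
  headsAfter-cut ℓ h []            = refl
  headsAfter-cut ℓ h ((p , v) ∷ T)
    with does (ℓ ∣? p) | cutStepsAtMultiples ℓ T | headsAfter-cut ℓ h T | headsAfter-cut ℓ v T
  ... | true  | []      | _    | ih-v = cong (v ∷_) ih-v
  ... | true  | _ ∷ _   | _    | ih-v = cong (v ∷_) ih-v
  ... | false | []      | ih-h | _    = cong (h ∷_) ih-h
  ... | false | _ ∷ _   | ih-h | _    = cong (h ∷_) ih-h

  runHeads : ℕ → List Tagged → List ℕ
  runHeads ℓ R = concatMap fillHead (segmentRun ℓ R)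

  runHeads-long : ∀ ℓ p w R → (length R <ᵇ ℓ) ≡ false →
                  runHeads ℓ ((p , w) ∷ R) ≡ cutHeads ℓ w ((p , w) ∷ R)
  runHeads-long ℓ p w R long rewrite long
    with does (ℓ ∣? p) | cutStepsAtMultiples ℓ R | headsAfter-cut ℓ w R
  ... | true  | []    | ih = cong (w ∷_) ih
  ... | true  | _ ∷ _ | ih = cong (w ∷_) ih
  ... | false | []    | ih = cong (w ∷_) ih
  ... | false | _ ∷ _ | ih = cong (w ∷_) ih

  runHeads-short : ∀ ℓ p w R → (length R <ᵇ ℓ) ≡ true →
                   runHeads ℓ ((p , w) ∷ R) ≡ map (const w) ((p , w) ∷ R)
  runHeads-short ℓ p w R short rewrite short = cong (w ∷_) (++-identityʳ (map (const w) R))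

  ∣suc-+-suc : ∀ {ℓ a t} → ℓ ∣ suc (suc a + t) → ℓ ∣ suc (a + suc t)
  ∣suc-+-suc {ℓ} {a} {t} = subst (ℓ ∣_) (cong suc (sym (+-suc a t)))

  ∣suc-+-suc⁻ : ∀ {ℓ a t} → ℓ ∣ suc (a + suc t) → ℓ ∣ suc (suc a + t)
  ∣suc-+-suc⁻ {ℓ} {a} {t} = subst (ℓ ∣_) (cong suc (+-suc a t))

  ∣suc-+-0 : ∀ {ℓ a} → ℓ ∣ suc a → ℓ ∣ suc (a + 0)
  ∣suc-+-0 {ℓ} {a} = subst (ℓ ∣_) (cong suc (sym (+-identityʳ a)))

  ∣suc-+-0⁻ : ∀ {ℓ a} → ℓ ∣ suc (a + 0) → ℓ ∣ suc a
  ∣suc-+-0⁻ {ℓ} {a} = subst (ℓ ∣_) (cong suc (+-identityʳ a))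

  NoCutUpTo : ℕ → ℕ → ℕ → Set
  NoCutUpTo ℓ a j = ∀ t → t ≤ j → ¬ ℓ ∣ suc (a + t)

  LastCutUpTo : ℕ → ℕ → ℕ → ℕ → Set
  LastCutUpTo ℓ a j s = s ≤ j × ℓ ∣ suc (a + s) × (∀ t → s < t → t ≤ j → ¬ ℓ ∣ suc (a + t))

  nth-cutHeads : ∀ ℓ a h vs j → j < length vs →
      (NoCutUpTo ℓ a j × nth (cutHeads ℓ h (tagFrom (suc a) vs)) j ≡ h)
    ⊎ (∃ λ s → LastCutUpTo ℓ a j s × nth (cutHeads ℓ h (tagFrom (suc a) vs)) j ≡ nth vs s)
  nth-cutHeads ℓ a h (w ∷ vs) j j<n with ℓ ∣? suc a
  nth-cutHeads ℓ a h (w ∷ vs) zero    _         | yes ℓ∣ =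
    inj₂ (0 , (z≤n , ∣suc-+-0 ℓ∣ , λ { t 0<t t≤0 → ⊥-elim (<⇒≱ 0<t t≤0) }) , refl)
  nth-cutHeads ℓ a h (w ∷ vs) (suc j) (s≤s j<n) | yes ℓ∣ with nth-cutHeads ℓ (suc a) w vs j j<n
  ... | inj₁ (none , e) = inj₂ (0 , (z≤n , ∣suc-+-0 ℓ∣ , later) , e)
    where
    later : ∀ t → 0 < t → t ≤ suc j → ¬ ℓ ∣ suc (a + t)
    later (suc t) _ (s≤s t≤j) = none t t≤j ∘ ∣suc-+-suc⁻
  ... | inj₂ (s , (s≤j , ℓ∣s , after) , e) = inj₂ (suc s , (s≤s s≤j , ∣suc-+-suc ℓ∣s , later) , e)
    where
    later : ∀ t → suc s < t → t ≤ suc j → ¬ ℓ ∣ suc (a + t)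
    later (suc t) (s≤s s<t) (s≤s t≤j) = after t s<t t≤j ∘ ∣suc-+-suc⁻
  nth-cutHeads ℓ a h (w ∷ vs) zero    _         | no ℓ∤ = inj₁ (none , refl)
    where
    none : NoCutUpTo ℓ a 0
    none zero _ = ℓ∤ ∘ ∣suc-+-0⁻
  nth-cutHeads ℓ a h (w ∷ vs) (suc j) (s≤s j<n) | no ℓ∤ with nth-cutHeads ℓ (suc a) h vs j j<n
  ... | inj₁ (none , e) = inj₁ (none′ , e)
    where
    none′ : NoCutUpTo ℓ a (suc j)
    none′ zero    _         = ℓ∤ ∘ ∣suc-+-0⁻
    none′ (suc t) (s≤s t≤j) = none t t≤j ∘ ∣suc-+-suc⁻
  ... | inj₂ (s , (s≤j , ℓ∣s , after) , e) = inj₂ (suc s , (s≤s s≤j , ∣suc-+-suc ℓ∣s , later) , e)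
    where
    later : ∀ t → suc s < t → t ≤ suc j → ¬ ℓ ∣ suc (a + t)
    later (suc t) (s≤s s<t) (s≤s t≤j) = after t s<t t≤j ∘ ∣suc-+-suc⁻

  length-cutHeads : ∀ ℓ h T → length (cutHeads ℓ h T) ≡ length T
  length-cutHeads ℓ h []            = refl
  length-cutHeads ℓ h ((p , v) ∷ T) with does (ℓ ∣? p)
  ... | true  = cong suc (length-cutHeads ℓ v T)
  ... | false = cong suc (length-cutHeads ℓ h T)

  length-runHeads : ∀ ℓ p w R → length (runHeads ℓ ((p , w) ∷ R)) ≡ suc (length R)
  length-runHeads ℓ p w R = byLength _ refl
    where
    byLength : ∀ b → (length R <ᵇ ℓ) ≡ b → length (runHeads ℓ ((p , w) ∷ R)) ≡ suc (length R)
    byLength true  short = trans (cong length (runHeads-short ℓ p w R short)) (length-map (const w) ((p , w) ∷ R))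
    byLength false long  = trans (cong length (runHeads-long ℓ p w R long)) (length-cutHeads ℓ w ((p , w) ∷ R))

  nth-map-const : ∀ (w : ℕ) (R : List Tagged) {t} → t < length R → nth (map (const w) R) t ≡ w
  nth-map-const w (r ∷ R) {zero}  _         = refl
  nth-map-const w (r ∷ R) {suc t} (s≤s t<n) = nth-map-const w R t<n

  taggedHeads : ℕ → List Tagged → List ℕ
  taggedHeads ℓ T = concatMap fillHead (concatMap (segmentRun ℓ) (runs T))

  taggedHeads-∷ : ∀ ℓ k x xs → taggedHeads ℓ (tagFrom k (x ∷ xs)) ≡
    runHeads ℓ (tagFrom k (x ∷ take (ascentLength x xs) xs))
      ++ taggedHeads ℓ (tagFrom (suc k + ascentLength x xs) (drop (ascentLength x xs) xs))
  taggedHeads-∷ ℓ k x xs rewrite runs-tagFrom k x xs =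
    concatMap-++ fillHead (segmentRun ℓ (tagFrom k (x ∷ take (ascentLength x xs) xs))) _

  segmentHeads≡taggedHeads : ∀ ℓ xs → segmentHeads ℓ xs ≡ taggedHeads ℓ (tagFrom 1 xs)
  segmentHeads≡taggedHeads ℓ xs = cong (taggedHeads ℓ) (withPositions≡tagFrom xs)

  -- Positions are 0-based here, the tag of position i being suc i.

  RunStart : (ℕ → ℕ) → ℕ → Set
  RunStart v zero    = ⊤
  RunStart v (suc q) = v (suc q) ≤ v q

  MaximalRun : (ℕ → ℕ) → ℕ → ℕ → ℕ → ℕ → Set
  MaximalRun v N a b i = a ≤ i × i ≤ b × b < N × RunStart v a
    × (∀ q → a < q → q ≤ b → ¬ RunStart v q) × (suc b ≡ N ⊎ RunStart v (suc b))

  LastCutIn : ℕ → ℕ → ℕ → ℕ → Set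
  LastCutIn ℓ a i s = a ≤ s × s ≤ i × (s ≡ a ⊎ ℓ ∣ suc s) × (∀ t → s < t → t ≤ i → ¬ ℓ ∣ suc t)

  SegmentStart : ℕ → ℕ → ℕ → ℕ → ℕ → Set
  SegmentStart ℓ a b i s = (b < a + ℓ × s ≡ a) ⊎ (a + ℓ ≤ b × LastCutIn ℓ a i s)

  HeadDescription : ℕ → (ℕ → ℕ) → ℕ → ℕ → List ℕ → ℕ → Set
  HeadDescription ℓ v N i heads j = ∃ λ a → ∃ λ b → ∃ λ s →
    MaximalRun v N a b i × SegmentStart ℓ a b i s × nth heads j ≡ v s

  nth-take-∷ : ∀ (y : ℕ) g ys {s} → s ≤ g → nth (y ∷ take g ys) s ≡ nth (y ∷ ys) s
  nth-take-∷ y g ys {zero}  _   = refl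
  nth-take-∷ y g ys {suc s} s<g = nth-take g ys s<g

  m≡n+[m∸n] : ∀ {m n} → n ≤ m → m ≡ n + (m ∸ n)
  m≡n+[m∸n] n≤m = sym (m+[n∸m]≡n n≤m)

  length-firstRunHeads : ∀ ℓ k y ys →
    length (runHeads ℓ (tagFrom k (y ∷ take (ascentLength y ys) ys))) ≡ suc (ascentLength y ys)
  length-firstRunHeads ℓ k y ys = trans (length-runHeads ℓ k y _) (cong suc (trans (length-tagFrom _ (take g ys))
    (trans (length-take g ys) (m≤n⇒m⊓n≡m (ascentLength≤length y ys)))))
    where g = ascentLength y ys

  module FirstRun (ℓ : ℕ) (v : ℕ → ℕ) (N k y : ℕ) (ys : List ℕ)
                  (values : ∀ j → nth (y ∷ ys) j ≡ v (k + j))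
                  (ends : k + suc (length ys) ≡ N) (starts : RunStart v k) where

    g : ℕ
    g = ascentLength y ys

    g≤n : g ≤ length ys
    g≤n = ascentLength≤length y ys

    rest : List Tagged
    rest = tagFrom (suc (suc k)) (take g ys)

    length-heads : length (runHeads ℓ (tagFrom (suc k) (y ∷ take g ys))) ≡ suc g
    length-heads = length-firstRunHeads ℓ (suc k) y ys

    length-rest : length rest ≡ g
    length-rest = suc-injective (trans (sym (length-runHeads ℓ (suc k) y rest)) length-heads)

    noStartInside : ∀ q → k < q → q ≤ k + g → ¬ RunStart v q
    noStartInside (suc q) k<1+q 1+q≤k+g = <⇒≱ (subst₂ _<_
        (trans (values t) (cong v (sym q≡k+t)))
        (trans (values (suc t)) (cong v (trans (+-suc k t) (cong suc (sym q≡k+t)))))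
        (ascent-increasing y ys t<g))
      where
      t = q ∸ k
      q≡k+t : q ≡ k + t
      q≡k+t = m≡n+[m∸n] (≤-pred k<1+q)
      t<g : t < g
      t<g = +-cancelˡ-< k t g (subst (_≤ k + g) (cong suc q≡k+t) 1+q≤k+g)

    endsOrStops : g ≡ length ys ⊎ RunStart v (suc (k + g))
    endsOrStops with ascent-stops y ys
    ... | inj₁ g≡n  = inj₁ g≡n
    ... | inj₂ y′≤y = inj₂ (subst₂ _≤_ (trans (values (suc g)) (cong v (+-suc k g))) (values g) y′≤y)

    stops : suc (k + g) ≡ N ⊎ RunStart v (suc (k + g))
    stops with endsOrStops
    ... | inj₁ g≡n   = inj₁ (trans (sym (+-suc k g)) (trans (cong (λ z → k + suc z) g≡n) ends))
    ... | inj₂ start = inj₂ start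

    maximal : ∀ {j} → j ≤ g → MaximalRun v N k (k + g) (k + j)
    maximal {j} j≤g = m≤m+n k j , +-monoʳ-≤ k j≤g , subst (k + g <_) ends (+-monoʳ-< k (s≤s g≤n))
                    , starts , noStartInside , stops

    segmentHead : ∀ {j} → j ≤ g → ∃ λ s →
      SegmentStart ℓ k (k + g) (k + j) s × nth (runHeads ℓ (tagFrom (suc k) (y ∷ take g ys))) j ≡ v s
    segmentHead {j} j≤g = byLength _ refl
      where
      y≡vk : y ≡ v k
      y≡vk = trans (values 0) (cong v (+-identityʳ k))
      j<n : j < length (y ∷ take g ys)
      j<n = s≤s (subst (j ≤_) (sym (trans (length-take g ys) (m≤n⇒m⊓n≡m g≤n))) j≤g)
      long⇒ : (length rest <ᵇ ℓ) ≡ false → k + ℓ ≤ k + g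
      long⇒ long = +-monoʳ-≤ k (subst (ℓ ≤_) length-rest (≮⇒≥ λ n<ℓ → subst T long (<⇒<ᵇ n<ℓ)))
      byLength : ∀ b → (length rest <ᵇ ℓ) ≡ b → ∃ λ s →
        SegmentStart ℓ k (k + g) (k + j) s × nth (runHeads ℓ (tagFrom (suc k) (y ∷ take g ys))) j ≡ v s
      byLength true short =
        k , inj₁ (+-monoʳ-< k (subst (_< ℓ) length-rest (<ᵇ⇒< _ ℓ (subst T (sym short) tt))) , refl)
          , trans (cong (λ hs → nth hs j) (runHeads-short ℓ (suc k) y rest short))
                  (trans (nth-map-const y ((suc k , y) ∷ rest) (subst (j <_) (sym (cong suc length-rest)) (s≤s j≤g)))
                         y≡vk)
      byLength false long with nth-cutHeads ℓ k y (y ∷ take g ys) j j<n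
      ... | inj₁ (none , e) =
        k , inj₂ (long⇒ long , ≤-refl , m≤m+n k j , inj₁ refl , noCut)
          , trans (cong (λ hs → nth hs j) (runHeads-long ℓ (suc k) y rest long)) (trans e y≡vk)
        where
        noCut : ∀ t → k < t → t ≤ k + j → ¬ ℓ ∣ suc t
        noCut t k<t t≤k+j ℓ∣ = none (t ∸ k)
          (+-cancelˡ-≤ k _ _ (subst (_≤ k + j) (m≡n+[m∸n] (<⇒≤ k<t)) t≤k+j))
          (subst (λ z → ℓ ∣ suc z) (m≡n+[m∸n] (<⇒≤ k<t)) ℓ∣)
      ... | inj₂ (s , (s≤j , ℓ∣ , after) , e) =
        k + s , inj₂ (long⇒ long , m≤m+n k s , +-monoʳ-≤ k s≤j , inj₂ ℓ∣ , noCut)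
          , trans (cong (λ hs → nth hs j) (runHeads-long ℓ (suc k) y rest long))
                  (trans e (trans (nth-take-∷ y g ys (≤-trans s≤j j≤g)) (values s)))
        where
        noCut : ∀ t → k + s < t → t ≤ k + j → ¬ ℓ ∣ suc t
        noCut t k+s<t t≤k+j ℓ∣t = after (t ∸ k)
          (+-cancelˡ-< k _ _ (subst (k + s <_) t≡ k+s<t))
          (+-cancelˡ-≤ k _ _ (subst (_≤ k + j) t≡ t≤k+j))
          (subst (λ z → ℓ ∣ suc z) t≡ ℓ∣t)
          where t≡ = m≡n+[m∸n] (≤-trans (m≤m+n k s) (<⇒≤ k+s<t))

  k+suc[g+j]≡suc[k+g]+j : ∀ k g j → k + suc (g + j) ≡ suc (k + g) + j
  k+suc[g+j]≡suc[k+g]+j k g j = trans (+-suc k (g + j)) (cong suc (sym (+-assoc k g j)))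

  -- The fuel m only makes the recursion over successive runs structural.
  taggedHeads-describe : ∀ ℓ v N m k ys → length ys ≤ m → (∀ j → nth ys j ≡ v (k + j)) →
    k + length ys ≡ N → RunStart v k →
    ∀ j → j < length ys → HeadDescription ℓ v N (k + j) (taggedHeads ℓ (tagFrom (suc k) ys)) j
  taggedHeads-describe ℓ v N (suc m) k (y ∷ ys) (s≤s n≤m) values ends starts j j<n
    rewrite taggedHeads-∷ ℓ (suc k) y ys with j ≤? ascentLength y ys
  ... | yes j≤g = let (s , start , e) = segmentHead j≤g in
    k , k + g , s , maximal j≤g , start
      , trans (nth-++ˡ (runHeads ℓ (tagFrom (suc k) (y ∷ take g ys))) _
                       (subst (j <_) (sym length-heads) (s≤s j≤g))) e
    where open FirstRun ℓ v N k y ys values ends starts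
  ... | no j≰g with FirstRun.endsOrStops ℓ v N k y ys values ends starts
  ...   | inj₁ g≡n   = ⊥-elim (j≰g (subst (j ≤_) (sym g≡n) (≤-pred j<n)))
  ...   | inj₂ start
    with taggedHeads-describe ℓ v N m (suc (k + g)) (drop g ys) n′≤m values′ ends′ start j′ j′<n′
    where
    open FirstRun ℓ v N k y ys values ends starts
    j′ = j ∸ suc g
    n′≤m : length (drop g ys) ≤ m
    n′≤m = subst (_≤ m) (sym (length-drop g ys)) (≤-trans (m∸n≤m (length ys) g) n≤m)
    values′ : ∀ i → nth (drop g ys) i ≡ v (suc (k + g) + i)
    values′ i = trans (nth-drop g ys i) (trans (values (suc (g + i))) (cong v (k+suc[g+j]≡suc[k+g]+j k g i)))
    ends′ : suc (k + g) + length (drop g ys) ≡ N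
    ends′ = trans (cong (suc (k + g) +_) (length-drop g ys))
      (trans (sym (k+suc[g+j]≡suc[k+g]+j k g (length ys ∸ g)))
             (trans (cong (λ z → k + suc z) (m+[n∸m]≡n g≤n)) ends))
    j′<n′ : j′ < length (drop g ys)
    j′<n′ = subst (j′ <_) (sym (length-drop g ys)) (∸-monoˡ-< j<n (≰⇒> j≰g))
  ... | a , b , s , run , start′ , e = a , b , s , subst (λ i → MaximalRun v N a b i) i≡ run
                                    , subst (λ i → SegmentStart ℓ a b i s) i≡ start′ , trans e′ e
    where
    open FirstRun ℓ v N k y ys values ends starts
    j′ = j ∸ suc g
    j≡ : j ≡ suc g + j′
    j≡ = m≡n+[m∸n] (≰⇒> j≰g)
    i≡ : suc (k + g) + j′ ≡ k + j
    i≡ = trans (sym (k+suc[g+j]≡suc[k+g]+j k g j′)) (cong (k +_) (sym j≡))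
    heads = runHeads ℓ (tagFrom (suc k) (y ∷ take g ys))
    later = taggedHeads ℓ (tagFrom (suc (suc k) + g) (drop g ys))
    e′ : nth (heads ++ later) j ≡ nth later j′
    e′ = trans (cong (nth (heads ++ later)) (trans j≡ (cong (_+ j′) (sym length-heads))))
               (nth-++ʳ heads later j′)

module Locality where

  open import Defs
  open SegmentHeads
  open import Data.Nat
  open import Data.Nat.Properties
  open import Data.Nat.DivMod using (_/_; _%_; m≡m%n+[m/n]*n; m%n<n; m/n*n≤m; m≥n⇒m/n>0)
  open import Data.Nat.Divisibility using (_∣_; divides)
  open import Data.List using (List; length)
  open import Data.Product using (_×_; _,_; proj₁; proj₂; ∃)
  open import Data.Sum using (_⊎_; inj₁; inj₂)
  open import Data.Empty using (⊥; ⊥-elim)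
  open import Relation.Nullary using (¬_; yes; no)
  open import Relation.Binary.Definitions using (tri<; tri≈; tri>)
  open import Relation.Binary.PropositionalEquality

  cut-nearBelow : ∀ ℓ → 1 ≤ ℓ → ∀ i → ℓ ≤ suc i → ∃ λ m → m ≤ i × i < m + ℓ × ℓ ∣ suc m
  cut-nearBelow (suc l) _ i ℓ≤1+i with suc i / suc l in q≡ | m≥n⇒m/n>0 {suc i} {suc l} ℓ≤1+i
  ... | suc q | _ = m , m≤i , i<m+ℓ , divides (suc q) refl
    where
    ℓ = suc l
    m = l + q * ℓ
    1+i≡ : suc i ≡ suc i % ℓ + suc m
    1+i≡ = trans (m≡m%n+[m/n]*n (suc i) ℓ) (cong (λ z → suc i % ℓ + z * ℓ) q≡)
    m≤i : m ≤ i
    m≤i = ≤-pred (subst (λ z → z * ℓ ≤ suc i) q≡ (m/n*n≤m (suc i) ℓ))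
    i<m+ℓ : i < m + ℓ
    i<m+ℓ = subst (_≤ m + ℓ) (sym 1+i≡)
      (subst (suc i % ℓ + suc m ≤_) (trans (+-suc l m) (trans (cong suc (+-comm l m)) (sym (+-suc m l))))
        (+-monoˡ-≤ (suc m) (≤-pred (m%n<n (suc i) ℓ))))

  -- Only run starts in this window can influence the segment containing i.
  InWindow : ℕ → ℕ → ℕ → Set
  InWindow ℓ i q = suc (suc i) ≤ q + (ℓ + ℓ) × q ≤ i + ℓ

  AgreeNear : (ℕ → ℕ) → (ℕ → ℕ) → ℕ → ℕ → Set
  AgreeNear v v′ ℓ i =
    ∀ q → InWindow ℓ i q → (RunStart v q → RunStart v′ q) × (RunStart v′ q → RunStart v q)

  AgreeNear-sym : ∀ {v v′ ℓ i} → AgreeNear v v′ ℓ i → AgreeNear v′ v ℓ i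
  AgreeNear-sym agree q q∈ = proj₂ (agree q q∈) , proj₁ (agree q q∈)

  InWindow-between : ∀ {ℓ i a q} → InWindow ℓ i a → a ≤ q → q ≤ i → InWindow ℓ i q
  InWindow-between {ℓ} {i} (lo , _) a≤q q≤i =
    ≤-trans lo (+-monoˡ-≤ (ℓ + ℓ) a≤q) , ≤-trans q≤i (m≤m+n i ℓ)

  runStart-local : ∀ {v v′ N ℓ i a b a′ b′} → InWindow ℓ i a → AgreeNear v v′ ℓ i →
                   MaximalRun v N a b i → MaximalRun v′ N a′ b′ i → a ≡ a′
  runStart-local {a = a} {a′ = a′} a∈ agree
    (a≤i , i≤b , _ , start , inside , _) (a′≤i , i≤b′ , _ , start′ , inside′ , _) with <-cmp a a′
  ... | tri< a<a′ _ _ = ⊥-elim (inside a′ a<a′ (≤-trans a′≤i i≤b)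
                          (proj₂ (agree a′ (InWindow-between a∈ (<⇒≤ a<a′) a′≤i)) start′))
  ... | tri≈ _ a≡a′ _ = a≡a′
  ... | tri> _ _ a′<a = ⊥-elim (inside′ a a′<a (≤-trans a≤i i≤b′) (proj₁ (agree a a∈) start))

  lastCut-maximal : ∀ {ℓ a i s m} → LastCutIn ℓ a i s → m ≤ i → ℓ ∣ suc m → m ≤ s
  lastCut-maximal (_ , _ , _ , after) m≤i ℓ∣ = ≮⇒≥ λ s<m → after _ s<m m≤i ℓ∣

  lastCut-unique : ∀ {ℓ a i s s′} → LastCutIn ℓ a i s → LastCutIn ℓ a i s′ → s′ ≤ s
  lastCut-unique cut (_ , _ , inj₁ s′≡a , _)  = subst (_≤ _) (sym s′≡a) (proj₁ cut)
  lastCut-unique cut (_ , s′≤i , inj₂ ℓ∣ , _) = lastCut-maximal cut s′≤i ℓ∣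

  shortRunEnd-inWindow : ∀ {ℓ a b i} → 1 ≤ ℓ → b < a + ℓ → a ≤ i → i ≤ b → InWindow ℓ i (suc b)
  shortRunEnd-inWindow {ℓ} {a} {b} ℓ≥1 b<a+ℓ a≤i i≤b =
    ≤-trans (s≤s (s≤s i≤b))
            (subst (_≤ suc b + (ℓ + ℓ)) (+-comm (suc b) 1) (+-monoʳ-≤ (suc b) (≤-trans ℓ≥1 (m≤m+n ℓ ℓ))))
    , ≤-trans b<a+ℓ (+-monoˡ-≤ ℓ a≤i)

  ¬short×long : ∀ {v v′ N ℓ i a b b′} → 1 ≤ ℓ → AgreeNear v v′ ℓ i →
                MaximalRun v N a b i → MaximalRun v′ N a b′ i → b < a + ℓ → a + ℓ ≤ b′ → ⊥
  ¬short×long ℓ≥1 agree (a≤i , i≤b , _ , _ , _ , ends) (_ , _ , b′<N , _ , inside′ , _) b<a+ℓ a+ℓ≤b′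
    with ends
  ... | inj₁ 1+b≡N = <⇒≱ b<a+ℓ (≤-trans a+ℓ≤b′ (≤-pred (subst (_ <_) (sym 1+b≡N) b′<N)))
  ... | inj₂ start = inside′ _ (s≤s (≤-trans a≤i i≤b)) (≤-trans b<a+ℓ a+ℓ≤b′)
                       (proj₁ (agree _ (shortRunEnd-inWindow ℓ≥1 b<a+ℓ a≤i i≤b)) start)

  segmentStart-sameRun : ∀ {v v′ N ℓ i a b s b′ s′} → 1 ≤ ℓ → AgreeNear v v′ ℓ i → InWindow ℓ i a →
    MaximalRun v N a b i → SegmentStart ℓ a b i s → MaximalRun v′ N a b′ i → SegmentStart ℓ a b′ i s′ →
    s ≡ s′ × InWindow ℓ i s
  segmentStart-sameRun _ _ a∈ _ (inj₁ (_ , s≡a)) _ (inj₁ (_ , s′≡a)) =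
    trans s≡a (sym s′≡a) , subst (InWindow _ _) (sym s≡a) a∈
  segmentStart-sameRun ℓ≥1 agree _ run (inj₁ (short , _)) run′ (inj₂ (long , _)) =
    ⊥-elim (¬short×long ℓ≥1 agree run run′ short long)
  segmentStart-sameRun ℓ≥1 agree _ run (inj₂ (long , _)) run′ (inj₁ (short , _)) =
    ⊥-elim (¬short×long ℓ≥1 (AgreeNear-sym agree) run′ run short long)
  segmentStart-sameRun _ _ a∈ _ (inj₂ (_ , cut)) _ (inj₂ (_ , cut′)) =
    ≤-antisym (lastCut-unique cut′ cut) (lastCut-unique cut cut′)
    , InWindow-between a∈ (proj₁ cut) (proj₁ (proj₂ cut))

  a+ℓ<a+[ℓ+ℓ] : ∀ {ℓ} a → 1 ≤ ℓ → a + ℓ < a + (ℓ + ℓ)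
  a+ℓ<a+[ℓ+ℓ] {ℓ} a ℓ≥1 = +-monoʳ-< a (m<m+n ℓ ℓ≥1)

  segmentStart-farRun : ∀ {ℓ i a b s m} → 1 ≤ ℓ → a + (ℓ + ℓ) ≤ suc i → i ≤ b →
    m ≤ i → i < m + ℓ → ℓ ∣ suc m → SegmentStart ℓ a b i s → LastCutIn ℓ a i s × ℓ ∣ suc s
  segmentStart-farRun {a = a} ℓ≥1 far i≤b _ _ _ (inj₁ (b<a+ℓ , _)) =
    ⊥-elim (<⇒≱ (a+ℓ<a+[ℓ+ℓ] a ℓ≥1) (≤-trans far (≤-trans (s≤s i≤b) b<a+ℓ)))
  segmentStart-farRun {ℓ} {a = a} {m = m} ℓ≥1 far i≤b m≤i i<m+ℓ ℓ∣ (inj₂ (_ , cut))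
    with proj₁ (proj₂ (proj₂ cut))
  ... | inj₂ ℓ∣s = cut , ℓ∣s
  ... | inj₁ s≡a = ⊥-elim (<⇒≱ a<m (subst (m ≤_) s≡a (lastCut-maximal cut m≤i ℓ∣)))
    where
    a<m : a < m
    a<m = <-≤-trans (m<m+n a ℓ≥1)
      (+-cancelʳ-≤ ℓ (a + ℓ) m (subst (_≤ m + ℓ) (sym (+-assoc a ℓ ℓ)) (≤-trans far i<m+ℓ)))

  lastCut-inWindow : ∀ {ℓ i m s} → 1 ≤ ℓ → m ≤ s → i < m + ℓ → s ≤ i → InWindow ℓ i s
  lastCut-inWindow {ℓ} {i} {m} {s} ℓ≥1 m≤s i<m+ℓ s≤i =
      ≤-trans (s≤s (≤-trans i<m+ℓ (+-monoˡ-≤ ℓ m≤s)))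
              (subst (_≤ s + (ℓ + ℓ)) (+-comm (s + ℓ) 1)
                     (subst (s + ℓ + 1 ≤_) (+-assoc s ℓ ℓ) (+-monoʳ-≤ (s + ℓ) ℓ≥1)))
    , ≤-trans s≤i (m≤m+n i ℓ)

  segmentStart-local : ∀ {v v′ N ℓ i a b s a′ b′ s′} → 1 ≤ ℓ → AgreeNear v v′ ℓ i →
    MaximalRun v N a b i → SegmentStart ℓ a b i s → MaximalRun v′ N a′ b′ i → SegmentStart ℓ a′ b′ i s′ →
    s ≡ s′ × InWindow ℓ i s
  segmentStart-local {ℓ = ℓ} {i} {a} {a′ = a′} ℓ≥1 agree run start run′ start′
    with suc (suc i) ≤? a + (ℓ + ℓ) | suc (suc i) ≤? a′ + (ℓ + ℓ)
  ... | yes near | _ with runStart-local (near , ≤-trans (proj₁ run) (m≤m+n i ℓ)) agree run run′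
  ...   | refl = segmentStart-sameRun ℓ≥1 agree (near , ≤-trans (proj₁ run) (m≤m+n i ℓ)) run start run′ start′
  segmentStart-local {ℓ = ℓ} {i} ℓ≥1 agree run start run′ start′ | no _ | yes near′
    with runStart-local (near′ , ≤-trans (proj₁ run′) (m≤m+n i ℓ)) (AgreeNear-sym agree) run′ run
  ... | refl = let (s′≡s , s′∈) = segmentStart-sameRun ℓ≥1 (AgreeNear-sym agree)
                                    (near′ , ≤-trans (proj₁ run′) (m≤m+n i ℓ)) run′ start′ run start
               in sym s′≡s , subst (InWindow ℓ i) s′≡s s′∈
  segmentStart-local {ℓ = ℓ} {i} {a} ℓ≥1 agree run start run′ start′ | no far | no far′
    with cut-nearBelow ℓ ℓ≥1 i (≤-trans (≤-trans (m≤m+n ℓ ℓ) (m≤n+m (ℓ + ℓ) a)) (≤-pred (≰⇒> far)))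
  ... | m , m≤i , i<m+ℓ , ℓ∣m
    with segmentStart-farRun ℓ≥1 (≤-pred (≰⇒> far)) (proj₁ (proj₂ run)) m≤i i<m+ℓ ℓ∣m start
       | segmentStart-farRun ℓ≥1 (≤-pred (≰⇒> far′)) (proj₁ (proj₂ run′)) m≤i i<m+ℓ ℓ∣m start′
  ... | cut , ℓ∣s | cut′ , ℓ∣s′ =
    ≤-antisym (lastCut-maximal cut′ (proj₁ (proj₂ cut)) ℓ∣s) (lastCut-maximal cut (proj₁ (proj₂ cut′)) ℓ∣s′)
    , lastCut-inWindow ℓ≥1 (lastCut-maximal cut m≤i ℓ∣m) i<m+ℓ (proj₁ (proj₂ cut))

  segmentHeads-describe : ∀ ℓ xs i → i < length xs →
    HeadDescription ℓ (nth xs) (length xs) i (segmentHeads ℓ xs) i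
  segmentHeads-describe ℓ xs i i<n rewrite segmentHeads≡taggedHeads ℓ xs =
    taggedHeads-describe ℓ (nth xs) (length xs) (length xs) 0 xs ≤-refl (λ _ → refl) refl _ i i<n

  -- A change at position c leaves every run start in the window of i intact.
  Far : ℕ → ℕ → ℕ → Set
  Far ℓ i c = i + ℓ < c ⊎ c + (ℓ + ℓ) ≤ i

  far-outside : ∀ {ℓ i c q} → Far ℓ i c → InWindow ℓ i q → suc q ≤ c ⊎ suc (suc c) ≤ q
  far-outside (inj₁ i+ℓ<c) (_ , q≤i+ℓ) = inj₁ (<-≤-trans (s≤s q≤i+ℓ) i+ℓ<c)
  far-outside {ℓ} {c = c} {q} (inj₂ c+2ℓ≤i) (lo , _) =
    inj₂ (+-cancelʳ-≤ (ℓ + ℓ) (suc (suc c)) q (≤-trans (s≤s (s≤s c+2ℓ≤i)) lo))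

  outside⇒≢ : ∀ {q c} → suc q ≤ c ⊎ suc (suc c) ≤ q → q ≢ c
  outside⇒≢ (inj₁ q<c)   q≡c = <-irrefl q≡c q<c
  outside⇒≢ (inj₂ c+1<q) q≡c = <-irrefl (sym q≡c) (≤-trans (n≤1+n _) c+1<q)

  outside⇒pred≢ : ∀ {q c} → suc (suc q) ≤ c ⊎ suc (suc c) ≤ suc q → q ≢ c
  outside⇒pred≢ (inj₁ q+1<c) q≡c = <-irrefl q≡c (≤-trans (n≤1+n _) q+1<c)
  outside⇒pred≢ (inj₂ c+1<q+1) q≡c = <-irrefl (sym q≡c) (≤-pred c+1<q+1)

  AgreeExcept : ℕ → ℕ → List ℕ → List ℕ → Set
  AgreeExcept c₁ c₂ xs xs′ = ∀ q → q ≢ c₁ → q ≢ c₂ → nth xs q ≡ nth xs′ q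

  AgreeExcept-sym : ∀ {c₁ c₂ xs xs′} → AgreeExcept c₁ c₂ xs xs′ → AgreeExcept c₁ c₂ xs′ xs
  AgreeExcept-sym agree q q≢c₁ q≢c₂ = sym (agree q q≢c₁ q≢c₂)

  segmentHeads-local : ∀ ℓ → 1 ≤ ℓ → ∀ {xs xs′ c₁ c₂} → length xs ≡ length xs′ → AgreeExcept c₁ c₂ xs xs′ →
    ∀ {i} → i < length xs → Far ℓ i c₁ → Far ℓ i c₂ → nth (segmentHeads ℓ xs) i ≡ nth (segmentHeads ℓ xs′) i
  segmentHeads-local ℓ ℓ≥1 {xs} {xs′} {c₁} {c₂} n≡n′ agree {i} i<n far₁ far₂
    with segmentHeads-describe ℓ xs i i<n | segmentHeads-describe ℓ xs′ i (subst (i <_) n≡n′ i<n)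
  ... | a , b , s , run , start , e | a′ , b′ , s′ , run′ , start′ , e′ =
    trans e (trans (agree s (outside⇒≢ (far-outside far₁ s∈)) (outside⇒≢ (far-outside far₂ s∈)))
                   (trans (cong (nth xs′) s≡s′) (sym e′)))
    where
    runStarts : AgreeNear (nth xs) (nth xs′) ℓ i
    runStarts zero    _   = (λ start → start) , (λ start → start)
    runStarts (suc q) q∈ =
        subst₂ _≤_ (agree (suc q) (outside⇒≢ (far-outside far₁ q∈)) (outside⇒≢ (far-outside far₂ q∈)))
                   (agree q (outside⇒pred≢ (far-outside far₁ q∈)) (outside⇒pred≢ (far-outside far₂ q∈)))
      , subst₂ _≤_ (sym (agree (suc q) (outside⇒≢ (far-outside far₁ q∈)) (outside⇒≢ (far-outside far₂ q∈))))
                   (sym (agree q (outside⇒pred≢ (far-outside far₁ q∈)) (outside⇒pred≢ (far-outside far₂ q∈))))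
    local = segmentStart-local ℓ≥1 runStarts run start
              (subst (λ N → MaximalRun (nth xs′) N a′ b′ i) (sym n≡n′) run′) start′
    s≡s′ = proj₁ local
    s∈ = proj₂ local

module Counting where

  open import Defs
  open SegmentHeads
  open Locality
  open import Data.Bool using (Bool; true; false; if_then_else_; _∨_; not)
  open import Data.Nat
  open import Data.Nat.Properties
  open import Data.List using (List; []; _∷_; length; _++_; take; drop)
  open import Data.List.Properties using (length-++; length-drop)
  open import Data.Product using (_×_; _,_; proj₁; proj₂)
  open import Data.Sum using (inj₁; inj₂)
  open import Data.Empty using (⊥-elim)
  open import Function using (_∘_)
  open import Relation.Nullary using (¬_; Dec; yes; no; does)
  open import Relation.Nullary.Decidable using (_⊎-dec_)
  open import Relation.Binary.PropositionalEquality

  count : (ℕ → Bool) → List ℕ → ℕ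
  count G []       = 0
  count G (x ∷ xs) = (if G x then 1 else 0) + count G xs

  count-++ : ∀ G u w → count G (u ++ w) ≡ count G u + count G w
  count-++ G []      w = refl
  count-++ G (x ∷ u) w =
    trans (cong ((if G x then 1 else 0) +_) (count-++ G u w)) (sym (+-assoc _ (count G u) (count G w)))

  if-1-0≤1 : ∀ b → (if b then 1 else 0) ≤ 1
  if-1-0≤1 true  = ≤-refl
  if-1-0≤1 false = z≤n

  countBelow : (ℕ → Bool) → ℕ → ℕ
  countBelow f zero    = 0
  countBelow f (suc n) = (if f 0 then 1 else 0) + countBelow (f ∘ suc) n

  count-≤-differ : ∀ G u u′ → length u ≡ length u′ → ∀ bad →
    (∀ i → i < length u → bad i ≡ false → nth u i ≡ nth u′ i) →
    count G u ≤ count G u′ + countBelow bad (length u)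
  count-≤-differ G []      []        _  bad agree = z≤n
  count-≤-differ G (x ∷ u) (x′ ∷ u′) n≡ bad agree with bad 0 in bad₀
  ... | true  = begin
    (if G x then 1 else 0) + count G u           ≤⟨ +-monoˡ-≤ (count G u) (if-1-0≤1 (G x)) ⟩
    suc (count G u)                              ≤⟨ s≤s ih ⟩
    suc (count G u′ + countBelow (bad ∘ suc) (length u)) ≡⟨ +-suc (count G u′) _ ⟨
    count G u′ + suc (countBelow (bad ∘ suc) (length u)) ≤⟨ +-monoˡ-≤ _ (m≤n+m (count G u′) _) ⟩
    count G (x′ ∷ u′) + suc (countBelow (bad ∘ suc) (length u)) ∎
    where
    open ≤-Reasoning
    ih = count-≤-differ G u u′ (suc-injective n≡) (bad ∘ suc) (λ i i<n → agree (suc i) (s≤s i<n))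
  ... | false rewrite agree 0 (s≤s z≤n) bad₀ =
    subst ((if G x′ then 1 else 0) + count G u ≤_)
      (sym (+-assoc (if G x′ then 1 else 0) (count G u′) (countBelow (bad ∘ suc) (length u))))
      (+-monoʳ-≤ (if G x′ then 1 else 0)
        (count-≤-differ G u u′ (suc-injective n≡) (bad ∘ suc) (λ i i<n → agree (suc i) (s≤s i<n))))

  countBelow-none : ∀ f n → (∀ i → f i ≡ false) → countBelow f n ≡ 0
  countBelow-none f zero    none = refl
  countBelow-none f (suc n) none rewrite none 0 = countBelow-none (f ∘ suc) n (none ∘ suc)

  countBelow-window : ∀ lo w n f → (∀ i → f i ≡ true → lo ≤ i × i < lo + w) → countBelow f n ≤ w
  countBelow-window lo       w       zero    f inside = z≤n
  countBelow-window (suc lo) w       (suc n) f inside with f 0 in f₀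
  ... | true  = ⊥-elim (1+n≰n (≤-trans (proj₁ (inside 0 f₀)) z≤n))
  ... | false = countBelow-window lo w n (f ∘ suc)
                  (λ i fi → let (lo≤ , <hi) = inside (suc i) fi in ≤-pred lo≤ , ≤-pred <hi)
  countBelow-window zero     zero    (suc n) f inside = ≤-reflexive (countBelow-none f (suc n) none)
    where
    none : ∀ i → f i ≡ false
    none i with f i in fi
    ... | true  = ⊥-elim (1+n≰n (≤-trans (proj₂ (inside i fi)) z≤n))
    ... | false = refl
  countBelow-window zero     (suc w) (suc n) f inside =
    +-mono-≤ (if-1-0≤1 (f 0))
             (countBelow-window zero w n (f ∘ suc) (λ i fi → z≤n , ≤-pred (proj₂ (inside (suc i) fi))))

  ∨≡false : ∀ {a b} → a ∨ b ≡ false → a ≡ false × b ≡ false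
  ∨≡false {false} b≡false = refl , b≡false

  countBelow-∨ : ∀ f g n → countBelow (λ i → f i ∨ g i) n ≤ countBelow f n + countBelow g n
  countBelow-∨ f g zero    = z≤n
  countBelow-∨ f g (suc n) with f 0 | g 0
  ... | true  | true  = s≤s (≤-trans (countBelow-∨ _ _ n) (+-monoʳ-≤ (countBelow (f ∘ suc) n) (n≤1+n _)))
  ... | true  | false = s≤s (countBelow-∨ _ _ n)
  ... | false | true  =
    subst (suc (countBelow (λ i → f (suc i) ∨ g (suc i)) n) ≤_) (sym (+-suc _ _)) (s≤s (countBelow-∨ _ _ n))
  ... | false | false = countBelow-∨ _ _ n

  length-taggedHeads : ∀ ℓ m k ys → length ys ≤ m → length (taggedHeads ℓ (tagFrom (suc k) ys)) ≡ length ys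
  length-taggedHeads ℓ m       k []       _         = refl
  length-taggedHeads ℓ (suc m) k (y ∷ ys) (s≤s n≤m) = begin
    length (taggedHeads ℓ (tagFrom (suc k) (y ∷ ys))) ≡⟨ cong length (taggedHeads-∷ ℓ (suc k) y ys) ⟩
    length (first ++ later)                           ≡⟨ length-++ first ⟩
    length first + length later                       ≡⟨ cong₂ _+_ length-heads length-later ⟩
    suc g + (length ys ∸ g)                           ≡⟨ cong suc (m+[n∸m]≡n g≤n) ⟩
    suc (length ys)                                   ∎
    where
    open ≡-Reasoning
    g = ascentLength y ys
    g≤n = ascentLength≤length y ys
    length-heads = length-firstRunHeads ℓ (suc k) y ys
    first = runHeads ℓ (tagFrom (suc k) (y ∷ take g ys))
    later = taggedHeads ℓ (tagFrom (suc (suc k) + g) (drop g ys))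
    length-later : length later ≡ length ys ∸ g
    length-later = trans (length-taggedHeads ℓ m (suc k + g) (drop g ys)
                           (subst (_≤ m) (sym (length-drop g ys)) (≤-trans (m∸n≤m (length ys) g) n≤m)))
                         (length-drop g ys)

  length-segmentHeads : ∀ ℓ xs → length (segmentHeads ℓ xs) ≡ length xs
  length-segmentHeads ℓ xs rewrite segmentHeads≡taggedHeads ℓ xs = length-taggedHeads ℓ (length xs) 0 xs ≤-refl

  far? : ∀ ℓ i c → Dec (Far ℓ i c)
  far? ℓ i c = (i + ℓ <? c) ⊎-dec (c + (ℓ + ℓ) ≤? i)

  near : ℕ → ℕ → ℕ → Bool
  near ℓ c i = not (does (far? ℓ i c))

  near≡false⇒far : ∀ {ℓ c i} → near ℓ c i ≡ false → Far ℓ i c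
  near≡false⇒far {ℓ} {c} {i} = byDecision (far? ℓ i c)
    where
    byDecision : (d : Dec (Far ℓ i c)) → not (does d) ≡ false → Far ℓ i c
    byDecision (yes far) _ = far

  near≡true⇒inRange : ∀ {ℓ c i} → near ℓ c i ≡ true → c ∸ ℓ ≤ i × i < c ∸ ℓ + (ℓ + ℓ + ℓ)
  near≡true⇒inRange {ℓ} {c} {i} = byDecision (far? ℓ i c)
    where
    open import Data.Nat.Tactic.RingSolver using (solve-∀)
    regroup : ∀ ℓ d → ℓ + d + (ℓ + ℓ) ≡ d + (ℓ + ℓ + ℓ)
    regroup = solve-∀
    byDecision : (d : Dec (Far ℓ i c)) → not (does d) ≡ true → c ∸ ℓ ≤ i × i < c ∸ ℓ + (ℓ + ℓ + ℓ)
    byDecision (no ¬far) _ =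
        subst (c ∸ ℓ ≤_) (m+n∸n≡m i ℓ) (∸-monoˡ-≤ ℓ (≮⇒≥ (¬far ∘ inj₁)))
      , <-≤-trans (≰⇒> (¬far ∘ inj₂))
                  (subst (c + (ℓ + ℓ) ≤_) (regroup ℓ (c ∸ ℓ)) (+-monoˡ-≤ (ℓ + ℓ) (m≤n+m∸n c ℓ)))

  countBelow-near : ∀ ℓ c n → countBelow (near ℓ c) n ≤ ℓ + ℓ + ℓ
  countBelow-near ℓ c n =
    countBelow-window (c ∸ ℓ) (ℓ + ℓ + ℓ) n (near ℓ c) (λ i → near≡true⇒inRange {ℓ} {c} {i})

  -- The heads can differ only at the at most 3ℓ positions near c₁ and the 3ℓ near c₂.
  count-segmentHeads-stable : ∀ ℓ → 1 ≤ ℓ → ∀ G xs xs′ {c₁ c₂} →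
    length xs ≡ length xs′ → AgreeExcept c₁ c₂ xs xs′ →
    count G (segmentHeads ℓ xs) ≤ count G (segmentHeads ℓ xs′) + ((ℓ + ℓ + ℓ) + (ℓ + ℓ + ℓ))
  count-segmentHeads-stable ℓ ℓ≥1 G xs xs′ {c₁} {c₂} n≡n′ agree =
    ≤-trans (count-≤-differ G heads heads′ n≡n′-heads nearChange sameHead)
            (+-monoʳ-≤ (count G heads′)
              (≤-trans (countBelow-∨ (near ℓ c₁) (near ℓ c₂) (length heads))
                       (+-mono-≤ (countBelow-near ℓ c₁ (length heads)) (countBelow-near ℓ c₂ (length heads)))))
    where
    heads = segmentHeads ℓ xs
    heads′ = segmentHeads ℓ xs′
    n≡n′-heads : length heads ≡ length heads′
    n≡n′-heads = trans (length-segmentHeads ℓ xs) (trans n≡n′ (sym (length-segmentHeads ℓ xs′)))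
    nearChange : ℕ → Bool
    nearChange i = near ℓ c₁ i ∨ near ℓ c₂ i
    sameHead : ∀ i → i < length heads → nearChange i ≡ false → nth heads i ≡ nth heads′ i
    sameHead i i<n notNear =
      segmentHeads-local ℓ ℓ≥1 {xs} {xs′} n≡n′ agree (subst (i <_) (length-segmentHeads ℓ xs) i<n)
        (near≡false⇒far {ℓ} {c₁} (proj₁ (∨≡false notNear))) (near≡false⇒far {ℓ} {c₂} (proj₂ (∨≡false notNear)))

module SegmentShapes where

  open import Defs
  open SegmentHeads
  open import Data.Bool using (true; false; if_then_else_; T)
  open import Data.Unit using (tt)
  open import Data.Nat
  open import Data.Nat.Properties
  open import Data.Nat.DivMod using (_/_; _%_; m≡m%n+[m/n]*n; m%n<n)
  open import Data.Nat.Divisibility using (_∣_; _∣?_; divides)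
  open import Data.List using (List; []; _∷_; length; concat; concatMap; _++_; take; drop)
  open import Data.List.Properties using (length-drop; ∷-injectiveˡ)
  open import Data.List.Relation.Unary.All as All using (All; []; _∷_)
  open import Data.List.Relation.Unary.All.Properties using (++⁺)
  open import Data.List.Relation.Unary.Linked as Linked using (Linked; []; [-]; _∷_)
  open import Data.Product using (_×_; _,_; proj₂; ∃)
  open import Function using (_on_)
  open import Relation.Nullary using (¬_; yes; no)
  open import Relation.Binary.PropositionalEquality

  Increasing : List Tagged → Set
  Increasing = Linked (_<_ on proj₂)

  Segment : ℕ → List Tagged → Set
  Segment ℓ s = 0 < length s × Increasing s × length s ≤ ℓ

  tagFrom-increasing : ∀ q vs → Linked _<_ vs → Increasing (tagFrom q vs)
  tagFrom-increasing q []          _            = []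
  tagFrom-increasing q (x ∷ [])    _            = [-]
  tagFrom-increasing q (x ∷ y ∷ r) (x<y ∷ y∷r↑) = x<y ∷ tagFrom-increasing (suc q) (y ∷ r) y∷r↑

  ascent-linked : ∀ y ys → Linked _<_ (y ∷ take (ascentLength y ys) ys)
  ascent-linked y []       = [-]
  ascent-linked y (z ∷ zs) with y <ᵇ z in y<z
  ... | true  = <ᵇ⇒< y z (subst T (sym y<z) tt) ∷ ascent-linked z zs
  ... | false = [-]

  noMultiple⇒short : ∀ ℓ → 1 ≤ ℓ → ∀ p K → (∀ t → t < K → ¬ ℓ ∣ p + t) → K < ℓ
  noMultiple⇒short (suc l) _ p K none with p % suc l in r≡
  ... | zero  = ≰⇒> λ ℓ≤K → none 0 (≤-trans (s≤s z≤n) ℓ≤K) (divides (p / suc l)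
                  (trans (+-identityʳ p) (trans (m≡m%n+[m/n]*n p (suc l)) (cong (_+ (p / suc l) * suc l) r≡))))
  ... | suc r = ≰⇒> λ ℓ≤K → none (suc l ∸ suc r) (<-≤-trans (s≤s (m∸n≤m l r)) ℓ≤K) (divides (suc q) p+t≡)
    where
    open ≡-Reasoning
    open import Data.Nat.Tactic.RingSolver using (solve-∀)
    q = p / suc l
    r<ℓ : suc r ≤ suc l
    r<ℓ = <⇒≤ (subst (_< suc l) r≡ (m%n<n p (suc l)))
    p≡ : p ≡ suc r + q * suc l
    p≡ = trans (m≡m%n+[m/n]*n p (suc l)) (cong (_+ q * suc l) r≡)
    regroup : ∀ a b c → a + b + c ≡ b + (a + c)
    regroup = solve-∀
    p+t≡ : p + (suc l ∸ suc r) ≡ suc q * suc l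
    p+t≡ = begin
      p + (suc l ∸ suc r)                 ≡⟨ cong (_+ (suc l ∸ suc r)) p≡ ⟩
      suc r + q * suc l + (suc l ∸ suc r) ≡⟨ regroup (suc r) (q * suc l) (suc l ∸ suc r) ⟩
      q * suc l + (suc r + (suc l ∸ suc r)) ≡⟨ cong (q * suc l +_) (m+[n∸m]≡n r<ℓ) ⟩
      q * suc l + suc l                   ≡⟨ +-comm (q * suc l) (suc l) ⟩
      suc q * suc l                       ∎

  CutPieces : ℕ → ℕ → List ℕ → Set
  CutPieces ℓ p vs = ∃ λ s₀ → ∃ λ ss →
      cutStepsAtMultiples ℓ (tagFrom p vs) ≡ s₀ ∷ ss × s₀ ++ concat ss ≡ tagFrom p vs
    × Increasing s₀ × (∀ t → t < length s₀ → ¬ ℓ ∣ p + t) × All (Segment ℓ) ss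

  increasing-∷ : ∀ p w vs s₀ rest → Linked _<_ (w ∷ vs) → s₀ ++ rest ≡ tagFrom (suc p) vs →
                 Increasing s₀ → Increasing ((p , w) ∷ s₀)
  increasing-∷ p w vs       []      rest _            _ _  = [-]
  increasing-∷ p w (v ∷ vs) (x ∷ r) rest (w<v ∷ _) s₀++≡ s₀↑ =
    subst (λ z → w < proj₂ z) (sym (∷-injectiveˡ s₀++≡)) w<v ∷ s₀↑

  cutPieces : ∀ ℓ → 1 ≤ ℓ → ∀ p vs → Linked _<_ vs → CutPieces ℓ p vs
  cutPieces ℓ ℓ≥1 p []       _   = [] , [] , refl , refl , [] , (λ _ ()) , []
  cutPieces ℓ ℓ≥1 p (w ∷ vs) w∷vs↑ with cutPieces ℓ ℓ≥1 (suc p) vs (Linked.tail w∷vs↑)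
  ... | s₀ , ss , cut≡ , concat≡ , s₀↑ , s₀-uncut , ss-segments with ℓ ∣? p
  ...   | yes _ = [] , ((p , w) ∷ s₀) ∷ ss , cong (cutStep true (p , w)) cut≡ , cong ((p , w) ∷_) concat≡ , []
                , (λ _ ()) , (s≤s z≤n , increasing-∷ p w vs s₀ (concat ss) w∷vs↑ concat≡ s₀↑
                             , noMultiple⇒short ℓ ℓ≥1 (suc p) (length s₀) s₀-uncut) ∷ ss-segments
  ...   | no ℓ∤p = (p , w) ∷ s₀ , ss , cong (cutStep false (p , w)) cut≡ , cong ((p , w) ∷_) concat≡
                 , increasing-∷ p w vs s₀ (concat ss) w∷vs↑ concat≡ s₀↑ , uncut , ss-segments
    where
    uncut : ∀ t → t < suc (length s₀) → ¬ ℓ ∣ p + t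
    uncut zero    _         ℓ∣ = ℓ∤p (subst (ℓ ∣_) (+-identityʳ p) ℓ∣)
    uncut (suc t) (s≤s t<n) ℓ∣ = s₀-uncut t t<n (subst (ℓ ∣_) (+-suc p t) ℓ∣)

  dropEmpty-segments : ∀ ℓ ss → All (λ s → 0 < length s → Segment ℓ s) ss → All (Segment ℓ) (dropEmpty ss)
  dropEmpty-segments ℓ []            []         = []
  dropEmpty-segments ℓ ([] ∷ ss)     (_ ∷ segs) = dropEmpty-segments ℓ ss segs
  dropEmpty-segments ℓ ((x ∷ r) ∷ ss) (seg ∷ segs) = seg (s≤s z≤n) ∷ dropEmpty-segments ℓ ss segs

  segmentRun-segments : ∀ ℓ → 1 ≤ ℓ → ∀ q v vs → Linked _<_ (v ∷ vs) →
                        All (Segment ℓ) (segmentRun ℓ (tagFrom q (v ∷ vs)))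
  segmentRun-segments ℓ ℓ≥1 q v vs run↑ = byLength _ refl
    where
    R = tagFrom q (v ∷ vs)
    byLength : ∀ b → (length R ≤ᵇ ℓ) ≡ b →
               All (Segment ℓ) (if b then R ∷ [] else dropEmpty (cutAtMultiples ℓ R))
    byLength true  short =
      (s≤s z≤n , tagFrom-increasing q (v ∷ vs) run↑ , ≤ᵇ⇒≤ _ _ (subst T (sym short) tt)) ∷ []
    byLength false _ with cutPieces ℓ ℓ≥1 q (v ∷ vs) run↑
    ... | s₀ , ss , cut≡ , _ , s₀↑ , s₀-uncut , ss-segments rewrite cut≡ =
      dropEmpty-segments ℓ (s₀ ∷ ss)
        ((λ n>0 → n>0 , s₀↑ , <⇒≤ (noMultiple⇒short ℓ ℓ≥1 q (length s₀) s₀-uncut))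
         ∷ All.map (λ seg _ → seg) ss-segments)

  taggedSegments : ∀ ℓ → 1 ≤ ℓ → ∀ m k ys → length ys ≤ m →
                   All (Segment ℓ) (concatMap (segmentRun ℓ) (runs (tagFrom (suc k) ys)))
  taggedSegments ℓ ℓ≥1 m       k []       _ = []
  taggedSegments ℓ ℓ≥1 (suc m) k (y ∷ ys) (s≤s n≤m) rewrite runs-tagFrom (suc k) y ys =
    ++⁺ (segmentRun-segments ℓ ℓ≥1 (suc k) y (take g ys) (ascent-linked y ys))
        (taggedSegments ℓ ℓ≥1 m (suc k + g) (drop g ys)
          (subst (_≤ m) (sym (length-drop g ys)) (≤-trans (m∸n≤m (length ys) g) n≤m)))
    where g = ascentLength y ys

  segments-segments : ∀ ℓ → 1 ≤ ℓ → ∀ xs → All (Segment ℓ) (segments ℓ xs)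
  segments-segments ℓ ℓ≥1 xs rewrite withPositions≡tagFrom xs =
    taggedSegments ℓ ℓ≥1 (length xs) 0 xs ≤-refl

module SortedSegments where

  open import Defs
  open SegmentHeads
  open Locality using (AgreeExcept; AgreeExcept-sym)
  open Counting
  open SegmentShapes
  open import Data.Bool using (Bool; true; false; if_then_else_; T)
  open import Data.Unit using (tt)
  open import Data.Nat
  open import Data.Nat.Properties
  open import Data.List using (List; []; _∷_; length; map; concat; concatMap; _++_; foldl)
  open import Data.List.Properties using (map-++; foldl-++; length-map)
  open import Data.List.Relation.Unary.All as All using (All; []; _∷_)
  open import Data.List.Relation.Unary.All.Properties using (map⁺; concat⁺)
  open import Data.List.Relation.Unary.AllPairs using (AllPairs; []; _∷_)
  import Data.List.Relation.Unary.Linked as Linked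
  open import Data.List.Relation.Unary.Linked.Properties using (Linked⇒All)
  open import Data.Product using (_×_; _,_; proj₁; proj₂)
  open import Data.Sum using (_⊎_; inj₁; inj₂)
  open import Function using (const; _on_)
  open import Relation.Binary.PropositionalEquality

  SortedHeads : List (List Tagged) → Set
  SortedHeads = AllPairs (λ s t → firstEntry s ≤ firstEntry t)

  insertSeg-All : ∀ (P : List Tagged → Set) {s} ts → P s → All P ts → All P (insertSeg s ts)
  insertSeg-All P         []       ps []         = ps ∷ []
  insertSeg-All P {s} (t ∷ ts) ps (pt ∷ pts) with firstEntry s ≤ᵇ firstEntry t
  ... | true  = ps ∷ pt ∷ pts
  ... | false = pt ∷ insertSeg-All P ts ps pts

  sortSegs-All : ∀ (P : List Tagged → Set) S → All P S → All P (sortSegs S)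
  sortSegs-All P []      []       = []
  sortSegs-All P (s ∷ S) (ps ∷ pS) = insertSeg-All P (sortSegs S) ps (sortSegs-All P S pS)

  insertSeg-sorted : ∀ s ts → SortedHeads ts → SortedHeads (insertSeg s ts)
  insertSeg-sorted s []       []                  = [] ∷ []
  insertSeg-sorted s (t ∷ ts) (t≤ts ∷ ts-sorted) with firstEntry s ≤ᵇ firstEntry t in s≤ᵇt
  ... | true  = (s≤t ∷ All.map (≤-trans s≤t) t≤ts) ∷ t≤ts ∷ ts-sorted
    where s≤t = ≤ᵇ⇒≤ _ _ (subst T (sym s≤ᵇt) tt)
  ... | false = insertSeg-All (λ u → firstEntry t ≤ firstEntry u) ts
                  (<⇒≤ (≰⇒> λ s≤t → subst T s≤ᵇt (≤⇒≤ᵇ s≤t))) t≤ts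
              ∷ insertSeg-sorted s ts ts-sorted

  sortSegs-sorted : ∀ S → SortedHeads (sortSegs S)
  sortSegs-sorted []      = []
  sortSegs-sorted (s ∷ S) = insertSeg-sorted s (sortSegs S) (sortSegs-sorted S)

  count-insertSeg : ∀ G s ts →
    count G (concatMap fillHead (insertSeg s ts)) ≡ count G (fillHead s) + count G (concatMap fillHead ts)
  count-insertSeg G s []       = count-++ G (fillHead s) []
  count-insertSeg G s (t ∷ ts) with firstEntry s ≤ᵇ firstEntry t
  ... | true  = count-++ G (fillHead s) (fillHead t ++ concatMap fillHead ts)
  ... | false = begin
    count G (fillHead t ++ concatMap fillHead (insertSeg s ts))  ≡⟨ count-++ G (fillHead t) _ ⟩
    c t + count G (concatMap fillHead (insertSeg s ts))          ≡⟨ cong (c t +_) (count-insertSeg G s ts) ⟩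
    c t + (c s + rest)                                            ≡⟨ +-assoc (c t) (c s) rest ⟨
    c t + c s + rest                                              ≡⟨ cong (_+ rest) (+-comm (c t) (c s)) ⟩
    c s + c t + rest                                              ≡⟨ +-assoc (c s) (c t) rest ⟩
    c s + (c t + rest)                                            ≡⟨ cong (c s +_) (count-++ G (fillHead t) _) ⟨
    c s + count G (fillHead t ++ concatMap fillHead ts)           ∎
    where
    open ≡-Reasoning
    c : List Tagged → ℕ
    c u = count G (fillHead u)
    rest = count G (concatMap fillHead ts)

  count-sortSegs : ∀ G S → count G (concatMap fillHead (sortSegs S)) ≡ count G (concatMap fillHead S)
  count-sortSegs G []      = refl
  count-sortSegs G (s ∷ S) = trans (count-insertSeg G s (sortSegs S))
    (trans (cong (count G (fillHead s) +_) (count-sortSegs G S)) (sym (count-++ G (fillHead s) _)))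

  count-map-const : ∀ G (c : ℕ) (s : List Tagged) → count G (map (const c) s) ≡ (if G c then length s else 0)
  count-map-const G c []      with G c
  ... | true  = refl
  ... | false = refl
  count-map-const G c (x ∷ s) with G c in Gc
  ... | true  = cong suc (trans (count-map-const G c s) (cong (λ b → if b then length s else 0) Gc))
  ... | false = trans (count-map-const G c s) (cong (λ b → if b then length s else 0) Gc)

  tagFrom-++ : ∀ k u w → tagFrom k (u ++ w) ≡ tagFrom k u ++ tagFrom (k + length u) w
  tagFrom-++ k []      w = cong (λ z → tagFrom z w) (sym (+-identityʳ k))
  tagFrom-++ k (x ∷ u) w = cong ((k , x) ∷_)
    (trans (tagFrom-++ (suc k) u w) (cong (λ z → tagFrom (suc k) u ++ tagFrom z w) (sym (+-suc k (length u)))))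

  increasing⇒headMinimal : ∀ {x r} → Increasing (x ∷ r) → All (λ t → proj₂ x ≤ proj₂ t) (x ∷ r)
  increasing⇒headMinimal {x} x∷r↑ = Linked⇒All {R = _≤_ on proj₂} ≤-trans {v = x} ≤-refl (Linked.map <⇒≤ x∷r↑)

  values : List (List Tagged) → List ℕ
  values S = map proj₂ (concat S)

  module LastGood (ℓ : ℕ) (G : ℕ → Bool) (G-down : ∀ {u v} → u ≤ v → G v ≡ true → G u ≡ true)
                  (step : ℕ → Tagged → ℕ) (step-spec : ∀ acc i v → step acc (i , v) ≡ (if G v then i else acc)) where

    lastGood : ℕ → ℕ → List ℕ → ℕ
    lastGood acc k w = foldl step acc (tagFrom k w)

    lastGood-range : ∀ acc k w →
      lastGood acc k w ≡ acc ⊎ (k ≤ lastGood acc k w × lastGood acc k w < k + length w)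
    lastGood-range acc k []      = inj₁ refl
    lastGood-range acc k (x ∷ w) rewrite step-spec acc k x
      with G x | lastGood-range (if G x then k else acc) (suc k) w
    ... | true  | inj₁ ≡k        =
      inj₂ (≤-reflexive (sym ≡k) , subst (_< k + suc (length w)) (sym ≡k) (m<m+n k (s≤s z≤n)))
    ... | false | inj₁ ≡acc      = inj₁ ≡acc
    ... | _     | inj₂ (lo , hi) =
      inj₂ (≤-trans (n≤1+n k) lo , <-≤-trans hi (≤-reflexive (sym (+-suc k (length w)))))

    lastGood-goodHead : ∀ acc k x w → G x ≡ true →
      k ≤ lastGood acc k (x ∷ w) × lastGood acc k (x ∷ w) < k + suc (length w)
    lastGood-goodHead acc k x w Gx rewrite step-spec acc k x | Gx with lastGood-range k (suc k) w
    ... | inj₁ ≡k        = ≤-reflexive (sym ≡k) , subst (_< k + suc (length w)) (sym ≡k) (m<m+n k (s≤s z≤n))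
    ... | inj₂ (lo , hi) = ≤-trans (n≤1+n k) lo , <-≤-trans hi (≤-reflexive (sym (+-suc k (length w))))

    lastGood-allBad : ∀ acc k w → All (λ v → G v ≡ false) w → lastGood acc k w ≡ acc
    lastGood-allBad acc k []      []          = refl
    lastGood-allBad acc k (x ∷ w) (Gx ∷ Gw) rewrite step-spec acc k x | Gx = lastGood-allBad acc (suc k) w Gw

    G-false-up : ∀ {u v} → u ≤ v → G u ≡ false → G v ≡ false
    G-false-up {u} {v} u≤v Gu with G v in Gv
    ... | true  = trans (sym (G-down u≤v Gv)) Gu
    ... | false = refl

    segment-allBad : ∀ s → Increasing s → G (firstEntry s) ≡ false → All (λ t → G (proj₂ t) ≡ false) s
    segment-allBad []      _   _    = []
    segment-allBad (x ∷ r) x∷r↑ Gx = All.map (λ x≤t → G-false-up x≤t Gx) (increasing⇒headMinimal x∷r↑)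

    BadHead : List Tagged → Set
    BadHead s = G (firstEntry s) ≡ false

    values-allBad : ∀ S → All (Segment ℓ) S → All BadHead S → All (λ v → G v ≡ false) (values S)
    values-allBad S segs bad =
      map⁺ (concat⁺ (All.zipWith (λ (seg , Gs) → segment-allBad _ (proj₁ (proj₂ seg)) Gs) (segs , bad)))

    count-allBadHeads : ∀ S → All BadHead S → count G (concatMap fillHead S) ≡ 0
    count-allBadHeads []      []         = refl
    count-allBadHeads (s ∷ S) (Gs ∷ bad) = trans (count-++ G (fillHead s) (concatMap fillHead S))
      (cong₂ _+_ (trans (count-map-const G (firstEntry s) s) (cong (λ b → if b then length s else 0) Gs))
                 (count-allBadHeads S bad))

    GoodCount : ℕ → ℕ → ℕ → ℕ → Set
    GoodCount acc k P L = (P ≡ 0 × L ≡ acc) ⊎ (k + P ≤ L + ℓ × L < k + P)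

    goodCount-goodFirst : ∀ s S → Segment ℓ s → G (firstEntry s) ≡ true → ∀ k acc →
      let L₁ = lastGood acc k (map proj₂ s)
          c  = count G (concatMap fillHead S)
          L  = lastGood L₁ (k + length s) (values S)
      in GoodCount L₁ (k + length s) c L → k + (length s + c) ≤ L + ℓ × L < k + (length s + c)
    goodCount-goodFirst (x ∷ r) S (_ , _ , s≤ℓ) Gx k acc rest
      with lastGood-goodHead acc k (proj₂ x) (map proj₂ r) Gx
    goodCount-goodFirst (x ∷ r) S (_ , _ , s≤ℓ) Gx k acc (inj₁ (c≡0 , L≡L₁)) | lo , hi
      rewrite c≡0 | L≡L₁ | +-identityʳ (suc (length r)) | length-map proj₂ r = +-mono-≤ lo s≤ℓ , hi
    goodCount-goodFirst (x ∷ r) S (_ , _ , s≤ℓ) Gx k acc (inj₂ (lo , hi)) | _ =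
        ≤-trans (≤-reflexive (sym (+-assoc k (suc (length r)) c))) lo
      , <-≤-trans hi (≤-reflexive (+-assoc k (suc (length r)) c))
      where c = count G (concatMap fillHead S)

    goodCount : ∀ S → All (Segment ℓ) S → SortedHeads S → ∀ k acc →
      GoodCount acc k (count G (concatMap fillHead S)) (lastGood acc k (values S))
    goodCount []      []           []                 k acc = inj₁ (refl , refl)
    goodCount (s ∷ S) (seg ∷ segs) (s≤S ∷ sorted) k acc
      rewrite map-++ proj₂ s (concat S) | tagFrom-++ k (map proj₂ s) (values S)
            | foldl-++ step acc (tagFrom k (map proj₂ s)) (tagFrom (k + length (map proj₂ s)) (values S))
            | count-++ G (fillHead s) (concatMap fillHead S) | count-map-const G (firstEntry s) s
            | length-map proj₂ s
      with G (firstEntry s) in Gs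
    ... | false = inj₁ (count-allBadHeads S badS
                      , trans (lastGood-allBad _ _ (values S) (values-allBad S segs badS))
                              (lastGood-allBad acc k (map proj₂ s) (map⁺ (segment-allBad s (proj₁ (proj₂ seg)) Gs))))
      where
      badS : All BadHead S
      badS = All.map (λ s≤t → G-false-up s≤t Gs) s≤S
    ... | true = inj₂ (goodCount-goodFirst s S seg Gs k acc
                         (goodCount S segs sorted (k + length s) (lastGood acc k (map proj₂ s))))

    lastGood-runsortBar : 1 ≤ ℓ → ∀ xs →
      let L = foldl step 0 (withPositions (runsortBar ℓ xs))
          P = count G (segmentHeads ℓ xs)
      in L ≤ P × P ≤ L + ℓ
    lastGood-runsortBar ℓ≥1 xs =
      subst₂ (λ L P → L ≤ P × P ≤ L + ℓ) (cong (foldl step 0) (sym (withPositions≡tagFrom (values S))))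
             (count-sortSegs G (segments ℓ xs))
             (bracket (goodCount S (sortSegs-All (Segment ℓ) (segments ℓ xs) (segments-segments ℓ ℓ≥1 xs))
                                 (sortSegs-sorted (segments ℓ xs)) 1 0))
      where
      S = sortSegs (segments ℓ xs)
      bracket : ∀ {P L} → GoodCount 0 1 P L → L ≤ P × P ≤ L + ℓ
      bracket (inj₁ (refl , refl)) = z≤n , z≤n
      bracket {P} (inj₂ (lo , hi)) = ≤-pred hi , ≤-trans (n≤1+n P) lo

  ∣m-n∣≤k : ∀ {m n k} → m ≤ n + k → n ≤ m + k → ∣ m - n ∣ ≤ k
  ∣m-n∣≤k {m} {n} {k} m≤n+k n≤m+k with ∣m-n∣≡[m∸n]∨[n∸m] m n
  ... | inj₁ ≡m∸n = subst (_≤ k) (sym ≡m∸n) (subst (m ∸ n ≤_) (m+n∸m≡n n k) (∸-monoˡ-≤ n m≤n+k))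
  ... | inj₂ ≡n∸m = subst (_≤ k) (sym ≡n∸m) (subst (n ∸ m ≤_) (m+n∸m≡n m k) (∸-monoˡ-≤ m n≤m+k))

  -- Two step functions, because the one local to L is parameterised by the permutation it reads.
  lastGood-stable : ∀ ℓ → 1 ≤ ℓ → (G : ℕ → Bool) → (∀ {u v} → u ≤ v → G v ≡ true → G u ≡ true) →
    ∀ step step′ → (∀ acc i v → step acc (i , v) ≡ (if G v then i else acc)) →
    (∀ acc i v → step′ acc (i , v) ≡ (if G v then i else acc)) →
    ∀ {xs xs′ c₁ c₂} → length xs ≡ length xs′ → AgreeExcept c₁ c₂ xs xs′ →
    ∣ foldl step 0 (withPositions (runsortBar ℓ xs)) - foldl step′ 0 (withPositions (runsortBar ℓ xs′)) ∣ ≤ 7 * ℓ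
  lastGood-stable ℓ ℓ≥1 G G-down step step′ spec spec′ {xs} {xs′} n≡n′ agree =
    ∣m-n∣≤k (chain (proj₁ bracket) (proj₂ bracket′) (count-segmentHeads-stable ℓ ℓ≥1 G xs xs′ n≡n′ agree))
            (chain (proj₁ bracket′) (proj₂ bracket)
                   (count-segmentHeads-stable ℓ ℓ≥1 G xs′ xs (sym n≡n′) (AgreeExcept-sym {xs = xs} {xs′} agree)))
    where
    open import Data.Nat.Tactic.RingSolver using (solve-∀)
    bracket = LastGood.lastGood-runsortBar ℓ G G-down step spec ℓ≥1 xs
    bracket′ = LastGood.lastGood-runsortBar ℓ G G-down step′ spec′ ℓ≥1 xs′
    seven : ∀ ℓ → ℓ + ((ℓ + ℓ + ℓ) + (ℓ + ℓ + ℓ)) ≡ 7 * ℓ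
    seven = solve-∀
    chain : ∀ {L₁ L₂ P₁ P₂} → L₁ ≤ P₁ → P₂ ≤ L₂ + ℓ → P₁ ≤ P₂ + ((ℓ + ℓ + ℓ) + (ℓ + ℓ + ℓ)) →
            L₁ ≤ L₂ + 7 * ℓ
    chain {L₁} {L₂} {P₁} {P₂} L₁≤P₁ P₂≤L₂+ℓ P₁≤P₂+6ℓ = begin
      L₁                                    ≤⟨ L₁≤P₁ ⟩
      P₁                                    ≤⟨ P₁≤P₂+6ℓ ⟩
      P₂ + ((ℓ + ℓ + ℓ) + (ℓ + ℓ + ℓ))      ≤⟨ +-monoˡ-≤ _ P₂≤L₂+ℓ ⟩
      L₂ + ℓ + ((ℓ + ℓ + ℓ) + (ℓ + ℓ + ℓ))  ≡⟨ +-assoc L₂ ℓ _ ⟩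
      L₂ + (ℓ + ((ℓ + ℓ + ℓ) + (ℓ + ℓ + ℓ))) ≡⟨ cong (L₂ +_) (seven ℓ) ⟩
      L₂ + 7 * ℓ                            ∎
      where open ≤-Reasoning

open import Defs
open SegmentHeads using (nth)
open Locality using (AgreeExcept)
open SortedSegments using (lastGood-stable)
open ExponentialSeries
open import Data.Bool using (Bool; true; if_then_else_)
open import Data.Nat as ℕ using (ℕ; zero; suc; _^_; ∣_-_∣; z≤n; s≤s)
import Data.Nat.Properties as ℕₚ
open import Data.Integer using (+_)
open import Data.Rational as ℚ using (ℚ; 0ℚ; 1ℚ; _≤_; _/_)
import Data.Rational.Properties as ℚₚ
open import Data.Fin as Fin using (Fin; zero; suc; toℕ)
open import Data.Fin.Properties using (0≢1+n)
open import Data.Fin.Permutation using (Permutation′; transpose; _∘ₚ_; _⟨$⟩ʳ_; inverseˡ)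
import Data.Fin.Permutation.Components as PC
open import Data.List using ([]; _∷_; length; tabulate; allFin)
open import Data.List.Properties using (map-tabulate; length-map)
open import Data.Product using (_×_; _,_)
open import Data.Empty using (⊥-elim)
open import Function using (_∘_)
open import Relation.Nullary using (Dec; does; yes; no)
open import Relation.Nullary.Decidable using (dec-true)
open import Relation.Binary.PropositionalEquality

atMost : ℕ → ℚ → ℕ → Bool
atMost n y v = does ((+ v / 1) ℚₚ.≤? (y ℚ.* (+ n / 1)))

atMost-down : ∀ n y {u v} → u ℕ.≤ v → atMost n y v ≡ true → atMost n y u ≡ true
atMost-down n y {u} {v} u≤v v≤yn = dec-true ((+ u / 1) ℚₚ.≤? (y ℚ.* (+ n / 1)))
  (ℚₚ.≤-trans (fromℕ-mono-≤ u≤v) (witness ((+ v / 1) ℚₚ.≤? (y ℚ.* (+ n / 1))) v≤yn))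
  where
  witness : ∀ {A : Set} (d : Dec A) → does d ≡ true → A
  witness (yes a) _ = a

transpose-other : ∀ {n} (i j k : Fin n) → k ≢ i → k ≢ j → PC.transpose i j k ≡ k
transpose-other i j k k≢i k≢j with k Fin.≟ i
... | yes k≡i = ⊥-elim (k≢i k≡i)
... | no _ with k Fin.≟ j
...   | yes k≡j = ⊥-elim (k≢j k≡j)
...   | no _    = refl

nth-tabulate-cong : ∀ {n} (h h′ : Fin n → ℕ) (P : ℕ → Set) → (∀ k → P (toℕ k) → h k ≡ h′ k) →
                    ∀ q → P q → nth (tabulate h) q ≡ nth (tabulate h′) q
nth-tabulate-cong {zero}  h h′ P h≡h′ q       _  = refl
nth-tabulate-cong {suc n} h h′ P h≡h′ zero    Pq = h≡h′ zero Pq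
nth-tabulate-cong {suc n} h h′ P h≡h′ (suc q) Pq =
  nth-tabulate-cong (λ k → h (suc k)) (λ k → h′ (suc k)) (λ z → P (suc z)) (λ k → h≡h′ (suc k)) q Pq

oneLine≡tabulate : ∀ {n} (ρ : Permutation′ n) → oneLine ρ ≡ tabulate (λ i → suc (toℕ (ρ ⟨$⟩ʳ i)))
oneLine≡tabulate ρ = map-tabulate (λ i → i) (λ i → suc (toℕ (ρ ⟨$⟩ʳ i)))

length-oneLine : ∀ {n} (π ρ : Permutation′ n) → length (oneLine π) ≡ length (oneLine ρ)
length-oneLine {n} π ρ = trans (length-map _ (allFin n)) (sym (length-map _ (allFin n)))

oneLine-transpose : ∀ {n} (π : Permutation′ n) i₁ i₂ →
                    AgreeExcept (toℕ i₁) (toℕ i₂) (oneLine π) (oneLine (transpose i₁ i₂ ∘ₚ π))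
oneLine-transpose {n} π i₁ i₂ q q≢i₁ q≢i₂
  rewrite oneLine≡tabulate π | oneLine≡tabulate (transpose i₁ i₂ ∘ₚ π) =
  nth-tabulate-cong _ _ (λ z → z ≢ toℕ i₁ × z ≢ toℕ i₂)
    (λ k (k≢i₁ , k≢i₂) → cong (λ z → suc (toℕ (π ⟨$⟩ʳ z)))
                              (sym (transpose-other i₁ i₂ k (k≢i₁ ∘ cong toℕ) (k≢i₂ ∘ cong toℕ))))
    q (q≢i₁ , q≢i₂)

oneLine-1 : (ρ : Permutation′ 1) → oneLine ρ ≡ 1 ∷ []
oneLine-1 ρ with ρ ⟨$⟩ʳ zero
... | zero = refl

runsortBar-0-2 : (ρ : Permutation′ 2) → runsortBar 0 (oneLine ρ) ≡ 1 ∷ 2 ∷ []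
runsortBar-0-2 ρ with ρ ⟨$⟩ʳ zero | ρ ⟨$⟩ʳ suc zero | inverseˡ ρ {zero} | inverseˡ ρ {suc zero}
... | zero     | zero     | back₀ | back₁ = ⊥-elim (0≢1+n (trans (sym back₀) back₁))
... | zero     | suc zero | _     | _     = refl
... | suc zero | zero     | _     | _     = refl
... | suc zero | suc zero | back₀ | back₁ = ⊥-elim (0≢1+n (trans (sym back₀) back₁))

∣L-L∣≡0 : ∀ n y {σ σ′} → σ ≡ σ′ → ∣ L n σ y - L n σ′ y ∣ ≡ 0
∣L-L∣≡0 n y {σ} refl = ℕₚ.∣n-n∣≡0 (L n σ y)

lemma3p2 : (n ℓ : ℕ) → IsFloorLog n ℓ → (y : ℚ) → 0ℚ ≤ y → y ≤ 1ℚ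
    → (π : Permutation′ n) → (i₁ i₂ : Fin n)
    → LogAtLeast (n ^ 9)
    ∣ L n (runsortBar ℓ (oneLine π)) y - L n (runsortBar ℓ (oneLine (transpose i₁ i₂ ∘ₚ π))) y ∣
lemma3p2 zero ℓ _ y _ _ π () _
lemma3p2 1 ℓ _ y _ _ π i₁ i₂ = subst (LogAtLeast 1)
  (sym (∣L-L∣≡0 1 y (cong (runsortBar ℓ) (trans (oneLine-1 π) (sym (oneLine-1 (transpose i₁ i₂ ∘ₚ π)))))))
  (LogAtLeast-zero ℕₚ.≤-refl)
lemma3p2 2 zero _ y _ _ π i₁ i₂ = subst (LogAtLeast (2 ^ 9))
  (sym (∣L-L∣≡0 2 y (trans (runsortBar-0-2 π) (sym (runsortBar-0-2 (transpose i₁ i₂ ∘ₚ π))))))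
  (LogAtLeast-zero {2 ^ 9} (s≤s z≤n))
lemma3p2 2 (suc ℓ) (eˡ≤2 , _) _ _ _ _ _ _ =
  ⊥-elim (¬LogAtLeast-2-1 (LogAtLeast-mono {2} {2} {suc ℓ} ℕₚ.≤-refl (s≤s z≤n) eˡ≤2))
lemma3p2 (suc (suc (suc n))) zero (_ , ¬e≤n) _ _ _ _ _ _ =
  ⊥-elim (¬e≤n (LogAtLeast-one {suc (suc (suc n))} (s≤s (s≤s (s≤s z≤n)))))
lemma3p2 N@(suc (suc (suc _))) ℓ@(suc _) (eˡ≤N , _) y _ _ π i₁ i₂ =
  LogAtLeast-mono {N ^ 7} {N ^ 9} (ℕₚ.^-monoʳ-≤ N (ℕₚ.m≤m+n 7 2))
    (lastGood-stable ℓ (s≤s z≤n) (atMost N y) (atMost-down N y) _ _ (λ _ _ _ → refl) (λ _ _ _ → refl)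
       (length-oneLine π (transpose i₁ i₂ ∘ₚ π)) (oneLine-transpose π i₁ i₂))
    (LogAtLeast-^ {N} {ℓ} eˡ≤N 7)
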